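{- Let $G=(V,E)$ be a finite graph and $C\subseteq V$ a clique with $n=|C|\ge3$. Let $G^-=(V^-,E^-)$ where $E^-=\{e\in E: e\not\subseteq C\}$ and $V^-=\bigcup E^-\cup(V\setminus C)$. Then $v(G)\le v(G^-)+n$, and $v(G)=v(G^-)+n$ if and only if either $C$ is a connected component of $G$, or $V^-\cap C=\{a\}$ for a vertex $a\notin\mathrm{Int}_e(G^-)$.
   Context: A clique is a set of pairwise adjacent vertices (empty set and singletons included). $v(H)$ is the linear intersection number of a graph $H$: the minimum number of points of a linear hypergraph (finite point set, lines are subsets of size $\ge2$, two distinct points in at most one line) whose intersection graph (vertices = lines, adjacent iff distinct and intersecting) is isomorphic to $H$; equivalently the minimum $r$ such that there is a list $C_1,\dots,C_r$ of cliques of $H$ with each edge in exactly one $C_i$ and each vertex in at least two $C_i$. A vertex $x$ with neighbourhood $H_x$ is interior if $H_x$ is a clique; an interior vertex $x$ is extremal if there is such a list with $r=v(H)$ and $H_x\cup\{x\}=C_i$ for some $i$. $\mathrm{Int}_e(H)$ is the set of extremal interior vertices of $H$. -}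

module Defs where

open import Data.Nat using (ℕ; zero; suc; _+_; _≤_)
open import Data.Bool using (Bool; true; false; _∧_; _∨_; not; if_then_else_)
open import Data.Fin using (Fin; _≟_)
open import Data.List using (List; []; _∷_; length; map)
open import Data.Nat.ListAction using (sum)
open import Data.Bool.ListAction using (any)
open import Data.List.Relation.Unary.All using (All)
open import Data.List.Relation.Unary.Any using (Any)
open import Data.Product using (Σ; ∃; _×_; _,_)
open import Relation.Binary.PropositionalEquality using (_≡_; _≢_)
open import Relation.Nullary using (¬_; ⌊_⌋)
open import Data.List using (allFin)

-- A finite graph on (a subset of) the vertex universe Fin N.
-- V x = true : x is a vertex;  E x y = true : x and y are adjacent.
record Graph (N : ℕ) : Set where
  constructor mkGraph
  field
    V : Fin N → Bool
    E : Fin N → Fin N → Bool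
open Graph public

record IsGraph {N : ℕ} (G : Graph N) : Set where
  field
    symm   : ∀ x y → E G x y ≡ E G y x
    irrefl : ∀ x → E G x x ≡ false
    closed : ∀ x y → E G x y ≡ true → V G x ≡ true

VSet : ℕ → Set
VSet N = Fin N → Bool

boolToℕ : Bool → ℕ
boolToℕ true  = 1
boolToℕ false = 0

card : {N : ℕ} → VSet N → ℕ
card {N} S = sum (map (λ x → boolToℕ (S x)) (allFin N))

-- cliques (empty set and singletons included)
Clique : {N : ℕ} → Graph N → VSet N → Set
Clique G S = (∀ x → S x ≡ true → V G x ≡ true)
           × (∀ x y → S x ≡ true → S y ≡ true → x ≢ y → E G x y ≡ true)

countIn : {N : ℕ} → List (VSet N) → Fin N → ℕ
countIn L x = sum (map (λ S → boolToℕ (S x)) L)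

countBoth : {N : ℕ} → List (VSet N) → Fin N → Fin N → ℕ
countBoth L x y = sum (map (λ S → boolToℕ (S x ∧ S y)) L)

Rep : {N : ℕ} → Graph N → List (VSet N) → Set
Rep G L = All (Clique G) L
        × (∀ x y → E G x y ≡ true → countBoth L x y ≡ 1)
        × (∀ x → V G x ≡ true → 2 ≤ countIn L x)

IsV : {N : ℕ} → Graph N → ℕ → Set
IsV G r = (Σ (List (VSet _)) λ L → Rep G L × length L ≡ r)
        × (∀ L → Rep G L → r ≤ length L)

Nbhd : {N : ℕ} → Graph N → Fin N → VSet N
Nbhd G x y = E G x y

ClosedNbhd : {N : ℕ} → Graph N → Fin N → VSet N
ClosedNbhd G x y = ⌊ x ≟ y ⌋ ∨ E G x y

Interior : {N : ℕ} → Graph N → Fin N → Set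
Interior G x = V G x ≡ true × Clique G (Nbhd G x)

ExtremalInterior : {N : ℕ} → Graph N → Fin N → Set
ExtremalInterior G x =
  Interior G x ×
  (Σ (List (VSet _)) λ L → Rep G L × IsV G (length L)
     × Any (λ S → ∀ y → S y ≡ ClosedNbhd G x y) L)

data Reach {N : ℕ} (G : Graph N) (S : VSet N) : Fin N → Fin N → Set where
  here : ∀ {x} → Reach G S x x
  step : ∀ {x y z} → E G x y ≡ true → S y ≡ true → Reach G S y z → Reach G S x z

ConnectedComponent : {N : ℕ} → Graph N → VSet N → Set
ConnectedComponent G S =
  (∃ λ x → S x ≡ true)
  × (∀ x → S x ≡ true → V G x ≡ true)
  × (∀ x y → S x ≡ true → E G x y ≡ true → S y ≡ true)
  × (∀ x y → S x ≡ true → S y ≡ true → Reach G S x y)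

Eminus : {N : ℕ} → Graph N → VSet N → Fin N → Fin N → Bool
Eminus G C x y = E G x y ∧ not (C x ∧ C y)

Vminus : {N : ℕ} → Graph N → VSet N → VSet N
Vminus {N} G C x = (V G x ∧ not (C x)) ∨ any (Eminus G C x) (allFin N)

Gminus : {N : ℕ} → Graph N → VSet N → Graph N
Gminus G C = mkGraph (Vminus G C) (Eminus G C)

-- Write n = |C| and A = V⁻ ∩ C. Adding the near-pencil on C (the line C ∖ {c} and the pairs {c, z})
-- to a representation of G⁻ represents G, so v(G) ≤ v(G⁻) + n. If |A| ≥ 2, or A = {a} with a
-- extremal in G⁻, one clique can be saved: C together with singletons on C ∖ A suffices, after
-- discarding, in the extremal case, the clique {a} that accompanies N[a].
-- Conversely, let |A| ≤ 1. The cliques of a representation of G that lie inside C form a linear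
-- space on C in which every point but a is on two lines, so by the de Bruijn–Erdős theorem (or
-- directly, if one line is all of C) there are at least n of them. The remaining cliques represent
-- G⁻, except that a may be covered only once; then its clique is N[a], and adding {a} gives a
-- representation of G⁻, which is minimal, making a extremal, unless v(G) ≥ v(G⁻) + n.

module Submission where

open import Defs
open import Data.Nat using (ℕ; _+_; _≤_)
open import Data.Bool using (true; _∧_)
open import Data.Fin using (Fin)
open import Data.Product using (Σ; _×_)
open import Data.Sum using (_⊎_)
open import Function.Bundles using (_⇔_; mk⇔)
open import Relation.Binary.PropositionalEquality using (_≡_)
open import Relation.Nullary using (¬_)

open import Data.Nat.Properties hiding (_≟_)
open import Data.Bool using (Bool; false; not; _∨_; if_then_else_)
open import Data.Bool.Properties using (¬-not)
import Data.Bool.Properties as Bool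
open import Data.Empty using (⊥; ⊥-elim)
open import Data.Sum using (inj₁; inj₂)
open import Data.Fin using (zero; suc; punchIn; punchOut; _≟_)
open import Data.Fin.Properties using (punchInᵢ≢i; punchIn-punchOut; any?; all?; ¬∀⟶∃¬)
open import Data.List using (List; []; _∷_; _++_; length; map; lookup; tabulate; allFin; filter; filterᵇ; removeAt)
open import Data.List.Properties using (map-tabulate; map-++; map-∘; length-map; length-removeAt′; length-++)
open import Data.List.Relation.Unary.All as All using (All; []; _∷_)
open import Data.List.Relation.Unary.All.Properties using (++⁺; all-filter; filter⁺; map⁺)
open import Data.List.Relation.Unary.Any as Any using (Any)
open import Data.List.Relation.Unary.Any.Properties using (lookup-index; ++⁺ˡ; any⁺; any⁻)
open import Data.List.Membership.Propositional.Properties using (∈-lookup; ∈-allFin)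
open import Data.Bool.ListAction using (any)
open import Data.Nat.ListAction.Properties using (sum-++)
import Data.Nat.ListAction as List
open import Data.Nat using (zero; suc; _*_; _∸_; _<_; z≤n; s≤s; >-nonZero)
open import Data.Nat.Tactic.RingSolver using (solve-∀)
open import Data.Product using (∃; _,_; proj₁; proj₂)
import Data.Vec.Functional as Vector
open import Function using (_∘_; id; Equivalence)
open import Relation.Binary.PropositionalEquality using (refl; sym; trans; cong; cong₂; subst; subst₂; _≢_; module ≡-Reasoning)
open import Relation.Nullary using (Dec; yes; no; ⌊_⌋; does; contradiction)
open import Relation.Nullary.Decidable using (T?; ¬?; _×-dec_; ⌊⌋-map′)
open import Relation.Unary using (Decidable)

open import Algebra.Properties.CommutativeSemigroup +-commutativeSemigroup using (x∙yz≈y∙xz)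
open import Algebra.Properties.Semiring.Sum +-*-semiring
  using (sum; sum-syntax; sum-remove; ∑-comm; *-distribˡ-sum; *-distribʳ-sum; ∑-distrib-+; sum-cong-≗)
open import Algebra.Properties.CommutativeMonoid.Sum *-1-commutativeMonoid
  using () renaming (sum to ∏; sum-remove to ∏-remove)

*-positive : ∀ {m n} → 0 < m → 0 < n → 0 < m * n
*-positive {suc m} {suc n} _ _ = s≤s z≤n

a*u≡b*v⇒v<u : ∀ {a b u v} → a * u ≡ b * v → a < b → 0 < v → v < u
a*u≡b*v⇒v<u {a} {b} {u} {v} eq a<b 0<v = *-cancelˡ-< a v u (begin-strict
  a * v  <⟨ *-monoˡ-< v ⦃ >-nonZero 0<v ⦄ a<b ⟩
  b * v  ≡⟨ eq ⟨
  a * u  ∎)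
  where open ≤-Reasoning

m+o≡n+p⇒p<o⇒m<n : ∀ {m n o p} → m + o ≡ n + p → p < o → m < n
m+o≡n+p⇒p<o⇒m<n eq p<o = ≰⇒> λ n≤m → <-irrefl (sym eq) (+-mono-≤-< n≤m p<o)

⌊≟⌋-refl : ∀ {n} (i : Fin n) → ⌊ i ≟ i ⌋ ≡ true
⌊≟⌋-refl i with i ≟ i
... | yes _   = refl
... | no i≢i = contradiction refl i≢i

⌊≟⌋-≢ : ∀ {n} {i j : Fin n} → i ≢ j → ⌊ i ≟ j ⌋ ≡ false
⌊≟⌋-≢ {i = i} {j} i≢j with i ≟ j
... | yes i≡j = contradiction i≡j i≢j
... | no _    = refl

⌊≟⌋⇒≡ : ∀ {n} {i j : Fin n} → ⌊ i ≟ j ⌋ ≡ true → i ≡ j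
⌊≟⌋⇒≡ {i = i} {j} e with i ≟ j
... | yes i≡j = i≡j

∧-true : ∀ {a b} → a ∧ b ≡ true → a ≡ true × b ≡ true
∧-true {true} {true} _ = refl , refl

not-true : ∀ {b} → not b ≡ true → b ≡ false
not-true {false} _ = refl

∨-true : ∀ {a b} → a ∨ b ≡ true → a ≡ true ⊎ b ≡ true
∨-true {true}  _  = inj₁ refl
∨-true {false} ab = inj₂ ab

boolToℕ≤1 : ∀ b → boolToℕ b ≤ 1
boolToℕ≤1 false = z≤n
boolToℕ≤1 true  = s≤s z≤n

boolToℕ-positive : ∀ {b} → 0 < boolToℕ b → b ≡ true
boolToℕ-positive {true} _ = refl

boolToℕ-∧ : ∀ a b → boolToℕ (a ∧ b) ≡ boolToℕ a * boolToℕ b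
boolToℕ-∧ false b = refl
boolToℕ-∧ true  b = sym (+-identityʳ (boolToℕ b))

boolToℕ-∧≤ : ∀ a b → boolToℕ (a ∧ b) ≤ boolToℕ a
boolToℕ-∧≤ false b = z≤n
boolToℕ-∧≤ true  b = boolToℕ≤1 b

boolToℕ-∧-not : ∀ a b → boolToℕ (a ∧ not b) + boolToℕ (a ∧ b) ≡ boolToℕ a
boolToℕ-∧-not false b     = refl
boolToℕ-∧-not true  false = refl
boolToℕ-∧-not true  true  = refl

∑-mono-≤ : ∀ {n} {f g : Fin n → ℕ} → (∀ i → f i ≤ g i) → sum f ≤ sum g
∑-mono-≤ {zero}  f≤g = z≤n
∑-mono-≤ {suc n} f≤g = +-mono-≤ (f≤g zero) (∑-mono-≤ (f≤g ∘ suc))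

∑-mono-< : ∀ {n} {f g : Fin n → ℕ} → (∀ i → f i ≤ g i) → ∀ j → f j < g j → sum f < sum g
∑-mono-< f≤g zero    fj<gj = +-mono-<-≤ fj<gj (∑-mono-≤ (f≤g ∘ suc))
∑-mono-< f≤g (suc j) fj<gj = +-mono-≤-< (f≤g zero) (∑-mono-< (f≤g ∘ suc) j fj<gj)

∑-const : ∀ n c → ∑[ i < n ] c ≡ n * c
∑-const zero    c = refl
∑-const (suc n) c = cong (c +_) (∑-const n c)

∑-zero : ∀ {n} {f : Fin n → ℕ} → (∀ i → f i ≡ 0) → sum f ≡ 0
∑-zero {n} f≡0 = trans (sum-cong-≗ f≡0) (trans (∑-const n 0) (*-zeroʳ n))

term≤∑ : ∀ {n} (f : Fin n → ℕ) i → f i ≤ sum f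
term≤∑ f zero    = m≤m+n (f zero) _
term≤∑ f (suc i) = ≤-trans (term≤∑ (f ∘ suc) i) (m≤n+m _ (f zero))

two-terms≤∑ : ∀ {n} (f : Fin n → ℕ) {i j} → i ≢ j → f i + f j ≤ sum f
two-terms≤∑ {zero}  f {()}
two-terms≤∑ {suc n} f {i} {j} i≢j = begin
  f i + f j                                 ≡⟨ cong (λ k → f i + f k) (punchIn-punchOut i≢j) ⟨
  f i + Vector.removeAt f i (punchOut i≢j)  ≤⟨ +-monoʳ-≤ (f i) (term≤∑ (Vector.removeAt f i) _) ⟩
  f i + sum (Vector.removeAt f i)           ≡⟨ sum-remove f ⟨
  sum f                                     ∎
  where open ≤-Reasoning

∑≤term+n : ∀ {n} (f : Fin n → ℕ) i → (∀ j → j ≢ i → f j ≤ 1) → sum f + 1 ≤ f i + n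
∑≤term+n {suc n} f i others≤1 = begin
  sum f + 1                            ≡⟨ cong (_+ 1) (sum-remove f) ⟩
  f i + sum (Vector.removeAt f i) + 1  ≤⟨ +-monoˡ-≤ 1 (+-monoʳ-≤ (f i) rest≤n) ⟩
  f i + n + 1                          ≡⟨ trans (+-assoc (f i) n 1) (cong (f i +_) (+-comm n 1)) ⟩
  f i + suc n                          ∎
  where
  open ≤-Reasoning
  rest≤n : sum (Vector.removeAt f i) ≤ n
  rest≤n = ≤-trans (∑-mono-≤ (λ k → others≤1 (punchIn i k) (punchInᵢ≢i i k)))
                   (≤-reflexive (trans (∑-const n 1) (*-identityʳ n)))

0<∑⇒∃ : ∀ {n} (f : Fin n → ℕ) → 0 < sum f → ∃ λ i → 0 < f i
0<∑⇒∃ {suc n} f 0<∑ with f zero in eq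
... | suc _ = zero , subst (0 <_) (sym eq) (s≤s z≤n)
... | zero  with 0<∑⇒∃ (f ∘ suc) 0<∑
...   | i , 0<fi = suc i , 0<fi

∑-delta : ∀ {n} (f : Fin n → ℕ) (i : Fin n) → ∑[ j < n ] (boolToℕ ⌊ i ≟ j ⌋ * f j) ≡ f i
∑-delta {suc n} f zero    = trans (cong₂ _+_ (+-identityʳ (f zero)) (∑-zero {n} (λ _ → refl))) (+-identityʳ (f zero))
∑-delta {suc n} f (suc i) =
  trans (sum-cong-≗ λ j → cong (λ b → boolToℕ b * f (suc j)) (⌊⌋-map′ _ _ (i ≟ j))) (∑-delta (f ∘ suc) i)

∏-except : ∀ {n} → (Fin n → ℕ) → Fin n → ℕ
∏-except {suc n} f i = ∏ (Vector.removeAt f i)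

∏-except-split : ∀ {n} (f : Fin n → ℕ) i → f i * ∏-except f i ≡ ∏ f
∏-except-split {suc n} f i = sym (∏-remove f)

∏-positive : ∀ {n} (f : Fin n → ℕ) → (∀ i → 0 < f i) → 0 < ∏ f
∏-positive {zero}  f 0<f = s≤s z≤n
∏-positive {suc n} f 0<f = *-positive (0<f zero) (∏-positive (f ∘ suc) (0<f ∘ suc))

∏-except-positive : ∀ {n} (f : Fin n → ℕ) → (∀ i → 0 < f i) → ∀ i → 0 < ∏-except f i
∏-except-positive {suc n} f 0<f i = ∏-positive (Vector.removeAt f i) (0<f ∘ punchIn i)

count : ∀ {n} → (Fin n → Bool) → ℕ
count {n} p = ∑[ i < n ] boolToℕ (p i)

count-unique : ∀ {n} (p : Fin n → Bool) → count p ≤ 1 → ∀ {i j} → p i ≡ true → p j ≡ true → i ≡ j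
count-unique p count≤1 {i} {j} pi pj with i ≟ j
... | yes i≡j = i≡j
... | no  i≢j = contradiction (≤-trans 2≤count count≤1) λ { (s≤s ()) }
  where
  2≤count : 2 ≤ count p
  2≤count = subst₂ (λ u v → u + v ≤ count p) (cong boolToℕ pi) (cong boolToℕ pj)
                   (two-terms≤∑ (boolToℕ ∘ p) i≢j)

count-other : ∀ {n} (p : Fin n → Bool) {i} → p i ≡ true → 2 ≤ count p → ∃ λ j → j ≢ i × p j ≡ true
count-other {suc n} p {i} pi 2≤count with 0<∑⇒∃ rest 1≤∑rest
  where
  rest = Vector.removeAt (boolToℕ ∘ p) i
  1≤∑rest : 1 ≤ sum rest
  1≤∑rest = +-cancelˡ-≤ 1 1 _
    (subst (2 ≤_) (trans (sum-remove {i = i} (boolToℕ ∘ p)) (cong (λ b → boolToℕ b + sum rest) pi)) 2≤count)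
... | k , 0<pk = punchIn i k , punchInᵢ≢i i k , boolToℕ-positive 0<pk

unique⇒count≤1 : ∀ {n} (p : Fin n → Bool) → (∀ {i j} → p i ≡ true → p j ≡ true → i ≡ j) → count p ≤ 1
unique⇒count≤1 p unique with 2 ≤? count p
... | no 2≰count = ≤-pred (≰⇒> 2≰count)
... | yes 2≤count with 0<∑⇒∃ (boolToℕ ∘ p) (≤-trans (s≤s z≤n) 2≤count)
...   | i , 0<pi with count-other p (boolToℕ-positive 0<pi) 2≤count
...     | j , j≢i , pj = contradiction (unique pj (boolToℕ-positive 0<pi)) j≢i

count-not : ∀ {n} (p : Fin n → Bool) → count (not ∘ p) + count p ≡ n
count-not {n} p = begin
  count (not ∘ p) + count p                         ≡⟨ ∑-distrib-+ (boolToℕ ∘ not ∘ p) (boolToℕ ∘ p) ⟨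
  ∑[ i < n ] (boolToℕ (not (p i)) + boolToℕ (p i))  ≡⟨ sum-cong-≗ (λ i → boolToℕ-∧-not true (p i)) ⟩
  ∑[ i < n ] 1                                      ≡⟨ trans (∑-const n 1) (*-identityʳ n) ⟩
  n                                                 ∎
  where open ≡-Reasoning

1≤count⇒∃ : ∀ {n} (p : Fin n → Bool) → 1 ≤ count p → ∃ λ i → p i ≡ true
1≤count⇒∃ p 1≤count with 0<∑⇒∃ (boolToℕ ∘ p) 1≤count
... | i , 0<pi = i , boolToℕ-positive 0<pi

∑-select : ∀ {n} (p : Fin n → Bool) i → ∑[ j < n ] (boolToℕ (p j) * boolToℕ ⌊ i ≟ j ⌋) ≡ boolToℕ (p i)
∑-select p i = trans (sum-cong-≗ λ j → *-comm (boolToℕ (p j)) _) (∑-delta (boolToℕ ∘ p) i)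

∑-two-points : ∀ {n} (p : Fin n → Bool) {x y} → x ≢ y → ∑[ z < n ] (boolToℕ (p z) * boolToℕ (⌊ x ≟ z ⌋ ∧ ⌊ y ≟ z ⌋)) ≡ 0
∑-two-points p {x} {y} x≢y = ∑-zero λ z → *-zero-at (p z) (distinct z)
  where
  distinct : ∀ z → (⌊ x ≟ z ⌋ ∧ ⌊ y ≟ z ⌋) ≡ false
  distinct z = ¬-not λ both → let (xz , yz) = ∧-true both in x≢y (trans (⌊≟⌋⇒≡ xz) (sym (⌊≟⌋⇒≡ yz)))
  *-zero-at : ∀ a {b} → b ≡ false → boolToℕ a * boolToℕ b ≡ 0
  *-zero-at a refl = *-zeroʳ (boolToℕ a)

-- Σ_{R p ℓ} 1 / (|A| · row p) and Σ_{R p ℓ} 1 / (k · col ℓ) both equal 1, so the second sum cannot be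
-- termwise smaller. The weights u and v are these fractions times the product of all the degrees
-- (a point off A counting with degree 1).
module Bipartite {m k} (A : Fin m → Bool) (R : Fin m → Fin k → Bool)
  (R⇒A : ∀ {p ℓ} → R p ℓ ≡ true → A p ≡ true)
  (0<row : ∀ {p} → A p ≡ true → 0 < count (R p))
  (0<col : ∀ ℓ → 0 < count (λ p → R p ℓ)) where

  open ≡-Reasoning

  row : Fin m → ℕ
  row p = count (R p)

  col : Fin k → ℕ
  col ℓ = count (λ p → R p ℓ)

  ρ : Fin m → ℕ
  ρ p = if A p then row p else 1

  ρ-positive : ∀ p → 0 < ρ p
  ρ-positive p = positive (A p) refl
    where
    positive : ∀ b → A p ≡ b → 0 < (if b then row p else 1)
    positive true  Ap = 0<row Ap
    positive false _  = s≤s z≤n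

  u : Fin m → ℕ
  u p = k * ∏ col * ∏-except ρ p

  v : Fin k → ℕ
  v ℓ = count A * ∏ ρ * ∏-except col ℓ

  row-weight : ∀ p → row p * u p ≡ boolToℕ (A p) * (k * ∏ col * ∏ ρ)
  row-weight p = weight (A p) refl
    where
    reorder : ∀ a b c d → a * (b * c * d) ≡ b * c * (a * d)
    reorder = solve-∀
    weight : ∀ b → A p ≡ b → row p * u p ≡ boolToℕ b * (k * ∏ col * ∏ ρ)
    weight true Ap = begin
      row p * u p                          ≡⟨ reorder (row p) k (∏ col) (∏-except ρ p) ⟩
      k * ∏ col * (row p * ∏-except ρ p)   ≡⟨ cong (λ r → k * ∏ col * (r * ∏-except ρ p)) row≡ρ ⟩
      k * ∏ col * (ρ p * ∏-except ρ p)     ≡⟨ cong (k * ∏ col *_) (∏-except-split ρ p) ⟩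
      k * ∏ col * ∏ ρ                      ≡⟨ +-identityʳ _ ⟨
      boolToℕ true * (k * ∏ col * ∏ ρ)     ∎
      where
      row≡ρ : row p ≡ ρ p
      row≡ρ = cong (λ b → if b then row p else 1) (sym Ap)
    weight false Ap = cong (_* u p) (∑-zero {k} λ ℓ → cong boolToℕ (¬-not λ Rpℓ → contradiction (trans (sym (R⇒A Rpℓ)) Ap) λ ()))

  col-weight : ∀ ℓ → col ℓ * v ℓ ≡ count A * ∏ ρ * ∏ col
  col-weight ℓ = begin
    col ℓ * v ℓ                                ≡⟨ reorder (col ℓ) (count A) (∏ ρ) (∏-except col ℓ) ⟩
    count A * ∏ ρ * (col ℓ * ∏-except col ℓ)   ≡⟨ cong (count A * ∏ ρ *_) (∏-except-split col ℓ) ⟩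
    count A * ∏ ρ * ∏ col                      ∎
    where
    reorder : ∀ a b c d → a * (b * c * d) ≡ b * c * (a * d)
    reorder = solve-∀

  D : ℕ
  D = count A * (k * ∏ col * ∏ ρ)

  Σu≡D : ∑[ p < m ] ∑[ ℓ < k ] (boolToℕ (R p ℓ) * u p) ≡ D
  Σu≡D = begin
    ∑[ p < m ] ∑[ ℓ < k ] (boolToℕ (R p ℓ) * u p)  ≡⟨ sum-cong-≗ (λ p → *-distribʳ-sum (u p) (boolToℕ ∘ R p)) ⟨
    ∑[ p < m ] (row p * u p)                       ≡⟨ sum-cong-≗ row-weight ⟩
    ∑[ p < m ] (boolToℕ (A p) * (k * ∏ col * ∏ ρ)) ≡⟨ *-distribʳ-sum (k * ∏ col * ∏ ρ) (boolToℕ ∘ A) ⟨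
    D                                              ∎

  Σv≡D : ∑[ p < m ] ∑[ ℓ < k ] (boolToℕ (R p ℓ) * v ℓ) ≡ D
  Σv≡D = begin
    ∑[ p < m ] ∑[ ℓ < k ] (boolToℕ (R p ℓ) * v ℓ)  ≡⟨ ∑-comm (λ p ℓ → boolToℕ (R p ℓ) * v ℓ) ⟩
    ∑[ ℓ < k ] ∑[ p < m ] (boolToℕ (R p ℓ) * v ℓ)  ≡⟨ sum-cong-≗ (λ ℓ → *-distribʳ-sum (v ℓ) (λ p → boolToℕ (R p ℓ))) ⟨
    ∑[ ℓ < k ] (col ℓ * v ℓ)                       ≡⟨ trans (sum-cong-≗ col-weight) (∑-const k (count A * ∏ ρ * ∏ col)) ⟩
    k * (count A * ∏ ρ * ∏ col)                    ≡⟨ reorder k (count A) (∏ ρ) (∏ col) ⟩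
    D                                              ∎
    where
    reorder : ∀ a b c d → a * (b * c * d) ≡ b * (a * d * c)
    reorder = solve-∀

  v<u : ∀ {p ℓ} → R p ℓ ≡ true → count A * row p < k * col ℓ → v ℓ < u p
  v<u {p} {ℓ} Rpℓ row<col = a*u≡b*v⇒v<u uD≡vD row<col 0<v
    where
    Ap : A p ≡ true
    Ap = R⇒A Rpℓ
    uD≡vD : count A * row p * u p ≡ k * col ℓ * v ℓ
    uD≡vD = begin
      count A * row p * u p                   ≡⟨ *-assoc (count A) (row p) (u p) ⟩
      count A * (row p * u p)                 ≡⟨ cong (count A *_) (trans (row-weight p) (cong (λ b → boolToℕ b * (k * ∏ col * ∏ ρ)) Ap)) ⟩
      count A * (1 * (k * ∏ col * ∏ ρ))       ≡⟨ reorder (count A) k (∏ ρ) (∏ col) ⟩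
      k * (count A * ∏ ρ * ∏ col)             ≡⟨ cong (k *_) (col-weight ℓ) ⟨
      k * (col ℓ * v ℓ)                       ≡⟨ *-assoc k (col ℓ) (v ℓ) ⟨
      k * col ℓ * v ℓ                         ∎
      where
      reorder : ∀ a b c d → a * (1 * (b * d * c)) ≡ b * (a * c * d)
      reorder = solve-∀
    0<v : 0 < v ℓ
    0<v = *-positive (*-positive (≤-trans (≤-reflexive (sym (cong boolToℕ Ap))) (term≤∑ (boolToℕ ∘ A) p))
                                 (∏-positive ρ ρ-positive))
                     (∏-except-positive col 0<col ℓ)

  reciprocal-degree-count : ∀ {p₀ ℓ₀} → R p₀ ℓ₀ ≡ true → ¬ (∀ {p ℓ} → R p ℓ ≡ true → count A * row p < k * col ℓ)
  reciprocal-degree-count {p₀} {ℓ₀} R₀ row<col = <-irrefl (trans Σv≡D (sym Σu≡D)) Σv<Σu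
    where
    edge-≤ : ∀ p ℓ → boolToℕ (R p ℓ) * v ℓ ≤ boolToℕ (R p ℓ) * u p
    edge-≤ p ℓ = weighted (R p ℓ) refl
      where
      weighted : ∀ b → R p ℓ ≡ b → boolToℕ b * v ℓ ≤ boolToℕ b * u p
      weighted true  Rpℓ = +-monoˡ-≤ 0 (<⇒≤ (v<u Rpℓ (row<col Rpℓ)))
      weighted false _   = z≤n
    Σv<Σu : ∑[ p < m ] ∑[ ℓ < k ] (boolToℕ (R p ℓ) * v ℓ) < ∑[ p < m ] ∑[ ℓ < k ] (boolToℕ (R p ℓ) * u p)
    Σv<Σu = ∑-mono-< (λ p → ∑-mono-≤ (edge-≤ p)) p₀ (∑-mono-< (edge-≤ p₀) ℓ₀
              (subst (λ b → boolToℕ b * v ℓ₀ < boolToℕ b * u p₀) (sym R₀) (+-monoˡ-< 0 (v<u R₀ (row<col R₀)))))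

sum-map-lookup : ∀ {A : Set} (g : A → ℕ) (xs : List A) →
                 List.sum (map g xs) ≡ ∑[ i < length xs ] g (lookup xs i)
sum-map-lookup g []       = refl
sum-map-lookup g (x ∷ xs) = cong (g x +_) (sum-map-lookup g xs)

sum-tabulate : ∀ {n} (f : Fin n → ℕ) → List.sum (tabulate f) ≡ sum f
sum-tabulate {zero}  f = refl
sum-tabulate {suc n} f = cong (f zero +_) (sum-tabulate (f ∘ suc))

sum-map-allFin : ∀ {n} (g : Fin n → ℕ) → List.sum (map g (allFin n)) ≡ sum g
sum-map-allFin g = trans (cong List.sum (map-tabulate id g)) (sum-tabulate g)

card≡count : ∀ {N} (S : VSet N) → card S ≡ count S
card≡count S = sum-map-allFin (boolToℕ ∘ S)

countIn≡count : ∀ {N} (L : List (VSet N)) x → countIn L x ≡ count (λ i → lookup L i x)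
countIn≡count L x = sum-map-lookup (λ S → boolToℕ (S x)) L

countBoth≡count : ∀ {N} (L : List (VSet N)) x y → countBoth L x y ≡ count (λ i → lookup L i x ∧ lookup L i y)
countBoth≡count L x y = sum-map-lookup (λ S → boolToℕ (S x ∧ S y)) L

module _ {A : Set} {P : A → Set} (P? : Decidable P) where

  sum-map-filter : ∀ (g : A → ℕ) xs →
                   List.sum (map g (filter P? xs)) ≡ List.sum (map (λ x → boolToℕ (does (P? x)) * g x) xs)
  sum-map-filter g []       = refl
  sum-map-filter g (x ∷ xs) with does (P? x)
  ... | true  = cong₂ _+_ (sym (+-identityʳ (g x))) (sum-map-filter g xs)
  ... | false = sum-map-filter g xs

  sum-map-partition : ∀ (g : A → ℕ) xs →
    List.sum (map g xs) ≡ List.sum (map g (filter P? xs)) + List.sum (map g (filter (¬? ∘ P?) xs))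
  sum-map-partition g []       = refl
  sum-map-partition g (x ∷ xs) with does (P? x)
  ... | true  = trans (cong (g x +_) (sum-map-partition g xs)) (sym (+-assoc (g x) _ _))
  ... | false = trans (cong (g x +_) (sum-map-partition g xs)) (x∙yz≈y∙xz (g x) (List.sum (map g (filter P? xs))) _)

  length-filter : ∀ xs → length (filter P? xs) ≡ List.sum (map (λ x → boolToℕ (does (P? x))) xs)
  length-filter []       = refl
  length-filter (x ∷ xs) with does (P? x)
  ... | true  = cong suc (length-filter xs)
  ... | false = length-filter xs

  length-partition : ∀ xs → length xs ≡ length (filter P? xs) + length (filter (¬? ∘ P?) xs)
  length-partition []       = refl
  length-partition (x ∷ xs) with does (P? x)
  ... | true  = cong suc (length-partition xs)
  ... | false = trans (cong suc (length-partition xs)) (sym (+-suc _ _))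

sum-map-zero : ∀ {A : Set} {g : A → ℕ} {xs} → All (λ x → g x ≡ 0) xs → List.sum (map g xs) ≡ 0
sum-map-zero []             = refl
sum-map-zero (gx≡0 ∷ gxs≡0) = cong₂ _+_ gx≡0 (sum-map-zero gxs≡0)

sum-map-removeAt : ∀ {A : Set} (g : A → ℕ) (xs : List A) i →
                   List.sum (map g xs) ≡ g (lookup xs i) + List.sum (map g (removeAt xs i))
sum-map-removeAt g (x ∷ xs) zero    = refl
sum-map-removeAt g (x ∷ xs) (suc i) =
  trans (cong (g x +_) (sum-map-removeAt g xs i)) (x∙yz≈y∙xz (g x) (g (lookup xs i)) _)

All-removeAt : ∀ {A : Set} {P : A → Set} {xs} → All P xs → ∀ i → All P (removeAt xs i)
All-removeAt (px ∷ pxs) zero    = pxs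
All-removeAt (px ∷ pxs) (suc i) = px ∷ All-removeAt pxs i

any-allFin⁺ : ∀ {n} (f : Fin n → Bool) {y} → f y ≡ true → any f (allFin n) ≡ true
any-allFin⁺ {n} f {y} fy =
  Equivalence.to Bool.T-≡ (any⁺ f (Any.map (λ { refl → Equivalence.from Bool.T-≡ fy }) (∈-allFin y)))

any-allFin⁻ : ∀ {n} (f : Fin n → Bool) → any f (allFin n) ≡ true → ∃ λ y → f y ≡ true
any-allFin⁻ {n} f any≡true with Any.satisfied (any⁻ f (allFin n) (Equivalence.from Bool.T-≡ any≡true))
... | y , fy = y , Equivalence.to Bool.T-≡ fy

module _ {N : ℕ} where

  countIn-++ : ∀ (L M : List (VSet N)) x → countIn (L ++ M) x ≡ countIn L x + countIn M x
  countIn-++ L M x = trans (cong List.sum (map-++ (λ S → boolToℕ (S x)) L M)) (sum-++ (map _ L) _)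

  countBoth-++ : ∀ (L M : List (VSet N)) x y → countBoth (L ++ M) x y ≡ countBoth L x y + countBoth M x y
  countBoth-++ L M x y = trans (cong List.sum (map-++ (λ S → boolToℕ (S x ∧ S y)) L M)) (sum-++ (map _ L) _)

  countBoth≤countIn : ∀ (L : List (VSet N)) x y → countBoth L x y ≤ countIn L x
  countBoth≤countIn L x y = begin
    countBoth L x y                          ≡⟨ countBoth≡count L x y ⟩
    count (λ i → lookup L i x ∧ lookup L i y) ≤⟨ ∑-mono-≤ (λ i → boolToℕ-∧≤ (lookup L i x) _) ⟩
    count (λ i → lookup L i x)               ≡⟨ countIn≡count L x ⟨
    countIn L x                              ∎
    where open ≤-Reasoning

  countIn-absent : ∀ {L : List (VSet N)} {x} → All (λ S → S x ≢ true) L → countIn L x ≡ 0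
  countIn-absent = sum-map-zero ∘ All.map (cong boolToℕ ∘ ¬-not)

  countBoth-absent : ∀ {L : List (VSet N)} {x y} → All (λ S → (S x ∧ S y) ≢ true) L → countBoth L x y ≡ 0
  countBoth-absent = sum-map-zero ∘ All.map (cong boolToℕ ∘ ¬-not)

PairsOnce : ∀ {N} → VSet N → List (VSet N) → Set
PairsOnce P L = ∀ x y → P x ≡ true → P y ≡ true → x ≢ y → countBoth L x y ≡ 1

module LinearSpace {N} (P : VSet N) (L : List (VSet N)) (pairs-once : PairsOnce P L) where

  line : Fin (length L) → VSet N
  line = lookup L

  degree : Fin N → ℕ
  degree x = count (λ i → line i x)

  size : Fin (length L) → ℕ
  size i = count (λ x → P x ∧ line i x)

  one-line-through : ∀ {x y} → P x ≡ true → P y ≡ true → x ≢ y → count (λ i → line i x ∧ line i y) ≡ 1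
  one-line-through {x} {y} Px Py x≢y = trans (sym (countBoth≡count L x y)) (pairs-once x y Px Py x≢y)

  line-through : ∀ {x y} → P x ≡ true → P y ≡ true → x ≢ y → ∃ λ i → line i x ≡ true × line i y ≡ true
  line-through Px Py x≢y with 0<∑⇒∃ _ (≤-reflexive (sym (one-line-through Px Py x≢y)))
  ... | i , 0<i = i , ∧-true (boolToℕ-positive 0<i)

  line-unique : ∀ {x y i j} → P x ≡ true → P y ≡ true → x ≢ y →
                line i x ≡ true → line i y ≡ true → line j x ≡ true → line j y ≡ true → i ≡ j
  line-unique Px Py x≢y ix iy jx jy =
    count-unique _ (≤-reflexive (one-line-through Px Py x≢y)) (cong₂ _∧_ ix iy) (cong₂ _∧_ jx jy)

  common-point-unique : ∀ {i j} → i ≢ j → ∀ {x y} → P x ≡ true → P y ≡ true →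
                        line i x ≡ true → line j x ≡ true → line i y ≡ true → line j y ≡ true → x ≡ y
  common-point-unique i≢j {x} {y} Px Py ix jx iy jy with x ≟ y
  ... | yes x≡y = x≡y
  ... | no  x≢y = contradiction (line-unique Px Py x≢y ix iy jx jy) i≢j

  meet≤1 : ∀ {i j} → i ≢ j → count (λ x → (P x ∧ line i x) ∧ line j x) ≤ 1
  meet≤1 i≢j = unique⇒count≤1 _ λ ex ey →
    let (Pix , jx) = ∧-true ex; (Px , ix) = ∧-true Pix
        (Piy , jy) = ∧-true ey; (Py , iy) = ∧-true Piy
    in common-point-unique i≢j Px Py ix jx iy jy

  size≤degree : ∀ {p ℓ} → P p ≡ true → line ℓ p ≡ false → size ℓ ≤ degree p
  size≤degree {p} {ℓ} Pp ℓp = begin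
    size ℓ
      ≡⟨ sum-cong-≗ on-ℓ ⟩
    ∑[ x < N ] (boolToℕ (P x ∧ line ℓ x) * count (λ j → line j p ∧ line j x))
      ≡⟨ sum-cong-≗ (λ x → *-distribˡ-sum (boolToℕ (P x ∧ line ℓ x)) (λ j → boolToℕ (line j p ∧ line j x))) ⟩
    ∑[ x < N ] ∑[ j < length L ] (boolToℕ (P x ∧ line ℓ x) * boolToℕ (line j p ∧ line j x))
      ≡⟨ ∑-comm (λ x j → boolToℕ (P x ∧ line ℓ x) * boolToℕ (line j p ∧ line j x)) ⟩
    ∑[ j < length L ] ∑[ x < N ] (boolToℕ (P x ∧ line ℓ x) * boolToℕ (line j p ∧ line j x))
      ≡⟨ sum-cong-≗ (λ j → trans (sum-cong-≗ (regroup j)) (sym (*-distribˡ-sum (boolToℕ (line j p)) (λ x → boolToℕ ((P x ∧ line ℓ x) ∧ line j x))))) ⟩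
    ∑[ j < length L ] (boolToℕ (line j p) * count (λ x → (P x ∧ line ℓ x) ∧ line j x))
      ≤⟨ ∑-mono-≤ through-p ⟩
    degree p
      ∎
    where
    open ≤-Reasoning
    on-ℓ : ∀ x → boolToℕ (P x ∧ line ℓ x) ≡ boolToℕ (P x ∧ line ℓ x) * count (λ j → line j p ∧ line j x)
    on-ℓ x with P x ∧ line ℓ x in Pℓx
    ... | false = refl
    ... | true  = sym (trans (+-identityʳ _) (one-line-through Pp Px p≢x))
      where
      Px = proj₁ (∧-true Pℓx)
      p≢x : p ≢ x
      p≢x refl = contradiction (trans (sym ℓp) (proj₂ (∧-true Pℓx))) λ ()
    regroup : ∀ j x → boolToℕ (P x ∧ line ℓ x) * boolToℕ (line j p ∧ line j x)
                    ≡ boolToℕ (line j p) * boolToℕ ((P x ∧ line ℓ x) ∧ line j x)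
    regroup j x rewrite boolToℕ-∧ (line j p) (line j x) | boolToℕ-∧ (P x ∧ line ℓ x) (line j x) =
      swap (boolToℕ (P x ∧ line ℓ x)) (boolToℕ (line j p)) (boolToℕ (line j x))
      where
      swap : ∀ a b c → a * (b * c) ≡ b * (a * c)
      swap = solve-∀
    through-p : ∀ j → boolToℕ (line j p) * count (λ x → (P x ∧ line ℓ x) ∧ line j x) ≤ boolToℕ (line j p)
    through-p j with line j p in jp
    ... | false = z≤n
    ... | true  = +-monoˡ-≤ 0 (meet≤1 ℓ≢j)
      where
      ℓ≢j : ℓ ≢ j
      ℓ≢j refl = contradiction (trans (sym ℓp) jp) λ ()

  degree-positive : 2 ≤ count P → ∀ {p} → P p ≡ true → 0 < degree p
  degree-positive 2≤|P| {p} Pp with count-other P Pp 2≤|P|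
  ... | q , q≢p , Pq = begin-strict
    0                                     <⟨ s≤s z≤n ⟩
    1                                     ≡⟨ one-line-through Pp Pq (q≢p ∘ sym) ⟨
    count (λ i → line i p ∧ line i q)     ≤⟨ ∑-mono-≤ (λ i → boolToℕ-∧≤ (line i p) (line i q)) ⟩
    degree p                              ∎
    where open ≤-Reasoning

  MissesPoint : Fin (length L) → Set
  MissesPoint i = ∃ λ x → P x ≡ true × line i x ≡ false

  misses-point? : Decidable MissesPoint
  misses-point? i = any? λ x → (P x Bool.≟ true) ×-dec (line i x Bool.≟ false)

  NoFullLine : Set
  NoFullLine = ∀ i → MissesPoint i

  missed-line : 2 ≤ count P → NoFullLine → ∀ {p} → P p ≡ true → ∃ λ m → line m p ≡ false
  missed-line 2≤|P| no-full-line {p} Pp with count-other P Pp 2≤|P|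
  ... | q , q≢p , Pq with line-through Pp Pq (q≢p ∘ sym)
  ...   | ℓ , ℓp , ℓq with no-full-line ℓ
  ...     | z , Pz , ℓz with line-through Pq Pz q≢z
    where
    q≢z : q ≢ z
    q≢z refl = contradiction (trans (sym ℓq) ℓz) λ ()
  ...       | m , mq , mz with line m p in mp
  ...         | false = m , mp
  ...         | true  = contradiction (trans (sym ℓz) (subst (λ i → line i z ≡ true) m≡ℓ mz)) λ ()
    where
    m≡ℓ : m ≡ ℓ
    m≡ℓ = line-unique Pp Pq (q≢p ∘ sym) mp mq ℓp ℓq

  incidences : ∑[ x < N ] (boolToℕ (P x) * degree x) ≡ ∑[ i < length L ] size i
  incidences = begin
    ∑[ x < N ] (boolToℕ (P x) * degree x)
      ≡⟨ sum-cong-≗ (λ x → *-distribˡ-sum (boolToℕ (P x)) (λ i → boolToℕ (line i x))) ⟩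
    ∑[ x < N ] ∑[ i < length L ] (boolToℕ (P x) * boolToℕ (line i x))
      ≡⟨ ∑-comm (λ x i → boolToℕ (P x) * boolToℕ (line i x)) ⟩
    ∑[ i < length L ] ∑[ x < N ] (boolToℕ (P x) * boolToℕ (line i x))
      ≡⟨ sum-cong-≗ (λ i → sum-cong-≗ λ x → boolToℕ-∧ (P x) (line i x)) ⟨
    ∑[ i < length L ] size i
      ∎
    where open ≡-Reasoning

  off : Fin N → Fin (length L) → Bool
  off p i = P p ∧ not (line i p)

  off-lines+degree : ∀ {p} → P p ≡ true → count (off p) + degree p ≡ length L
  off-lines+degree {p} Pp =
    trans (cong (_+ degree p) (sum-cong-≗ λ i → cong (λ a → boolToℕ (a ∧ not (line i p))) Pp))
          (count-not (λ i → line i p))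

  off-points+size : ∀ i → count (λ x → off x i) + size i ≡ count P
  off-points+size i = trans (sym (∑-distrib-+ (λ x → boolToℕ (off x i)) (λ x → boolToℕ (P x ∧ line i x))))
                            (sum-cong-≗ λ x → boolToℕ-∧-not (P x) (line i x))

  -- With b = length L, n = count P, r = degree p and k = size i this is n (b − r) < b (n − k),
  -- which follows from k ≤ r, 1 ≤ r and b < n.
  off-heavier : 2 ≤ count P → length L < count P →
                ∀ {p i} → off p i ≡ true → count P * count (off p) < length L * count (λ x → off x i)
  off-heavier 2≤|P| b<n {p} {i} off-pi = m+o≡n+p⇒p<o⇒m<n both≡nb (begin-strict
    b * size i    ≤⟨ *-monoʳ-≤ b (size≤degree Pp ip) ⟩
    b * degree p  <⟨ *-monoˡ-< (degree p) ⦃ >-nonZero (degree-positive 2≤|P| Pp) ⦄ b<n ⟩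
    n * degree p  ∎)
    where
    open ≤-Reasoning
    b = length L
    n = count P
    Pp = proj₁ (∧-true off-pi)
    ip : line i p ≡ false
    ip = not-true (proj₂ (∧-true off-pi))
    both≡nb : n * count (off p) + n * degree p ≡ b * count (λ x → off x i) + b * size i
    both≡nb = begin-equality
      n * count (off p) + n * degree p             ≡⟨ *-distribˡ-+ n _ _ ⟨
      n * (count (off p) + degree p)               ≡⟨ cong (n *_) (off-lines+degree Pp) ⟩
      n * b                                        ≡⟨ *-comm n b ⟩
      b * n                                        ≡⟨ cong (b *_) (off-points+size i) ⟨
      b * (count (λ x → off x i) + size i)         ≡⟨ *-distribˡ-+ b _ _ ⟩
      b * count (λ x → off x i) + b * size i       ∎

  de-Bruijn–Erdős : 2 ≤ count P → NoFullLine → count P ≤ length L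
  de-Bruijn–Erdős 2≤|P| no-full-line = ≮⇒≥ λ b<n →
    Bipartite.reciprocal-degree-count P off (proj₁ ∘ ∧-true) some-line-off some-point-off off₀ (off-heavier 2≤|P| b<n)
    where
    off-of-missed : ∀ {p i} → P p ≡ true → line i p ≡ false → off p i ≡ true
    off-of-missed Pp ip = cong₂ (λ a c → a ∧ not c) Pp ip

    some-line-off : ∀ {p} → P p ≡ true → 0 < count (off p)
    some-line-off {p} Pp with missed-line 2≤|P| no-full-line Pp
    ... | m , mp = ≤-trans (≤-reflexive (cong boolToℕ (sym (off-of-missed Pp mp)))) (term≤∑ (boolToℕ ∘ off p) m)

    some-point-off : ∀ i → 0 < count (λ x → off x i)
    some-point-off i with no-full-line i
    ... | x , Px , ix = ≤-trans (≤-reflexive (cong boolToℕ (sym (off-of-missed Px ix)))) (term≤∑ (λ x → boolToℕ (off x i)) x)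

    Pp₀ = proj₂ (1≤count⇒∃ P (≤-trans (s≤s z≤n) 2≤|P|))
    off₀ = off-of-missed Pp₀ (proj₂ (missed-line 2≤|P| no-full-line Pp₀))

  full-line-bound : ∀ ℓ → (∀ x → P x ≡ true → line ℓ x ≡ true) →
                    ∀ a → (∀ x → P x ≡ true → x ≢ a → 2 ≤ degree x) → count P ≤ length L
  full-line-bound ℓ full a deg = +-cancelˡ-≤ n n b (begin
    n + n                                           ≡⟨ ∑-distrib-+ (boolToℕ ∘ P) (boolToℕ ∘ P) ⟨
    ∑[ x < N ] (boolToℕ (P x) + boolToℕ (P x))      ≤⟨ ∑-mono-≤ twice ⟩
    ∑[ x < N ] (boolToℕ (P x) * degree x + boolToℕ ⌊ a ≟ x ⌋ * 1)
                                                    ≡⟨ ∑-distrib-+ (λ x → boolToℕ (P x) * degree x) _ ⟩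
    ∑[ x < N ] (boolToℕ (P x) * degree x) + ∑[ x < N ] (boolToℕ ⌊ a ≟ x ⌋ * 1)
                                                    ≡⟨ cong₂ _+_ incidences (∑-delta (λ _ → 1) a) ⟩
    sum size + 1                                    ≤⟨ ∑≤term+n size ℓ others-small ⟩
    size ℓ + b                                      ≤⟨ +-monoˡ-≤ b (∑-mono-≤ (λ x → boolToℕ-∧≤ (P x) (line ℓ x))) ⟩
    n + b                                           ∎)
    where
    open ≤-Reasoning
    b = length L
    n = count P

    twice : ∀ x → boolToℕ (P x) + boolToℕ (P x) ≤ boolToℕ (P x) * degree x + boolToℕ ⌊ a ≟ x ⌋ * 1
    twice x with P x in Px | a ≟ x
    ... | false | _        = z≤n
    ... | true  | yes refl = +-mono-≤ (≤-trans on-ℓ (m≤m+n _ 0)) (s≤s z≤n)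
      where
      on-ℓ : 1 ≤ degree x
      on-ℓ = ≤-trans (≤-reflexive (cong boolToℕ (sym (full x Px)))) (term≤∑ (λ i → boolToℕ (line i x)) ℓ)
    ... | true  | no a≢x   = ≤-trans (deg x Px (a≢x ∘ sym)) (≤-trans (m≤m+n _ 0) (m≤m+n _ _))

    others-small : ∀ j → j ≢ ℓ → size j ≤ 1
    others-small j j≢ℓ = unique⇒count≤1 _ λ {x} {y} ex ey →
      let (Px , jx) = ∧-true ex; (Py , jy) = ∧-true ey
      in common-point-unique j≢ℓ Px Py jx (full x Px) jy (full y Py)

  points≤lines : 2 ≤ count P → ∀ a → (∀ x → P x ≡ true → x ≢ a → 2 ≤ degree x) → count P ≤ length L
  points≤lines 2≤|P| a deg with all? misses-point?
  ... | yes no-full-line = de-Bruijn–Erdős 2≤|P| no-full-line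
  ... | no  some-full-line with ¬∀⟶∃¬ _ _ misses-point? some-full-line
  ...   | ℓ , ℓ-full = full-line-bound ℓ (λ x Px → ¬-not λ ℓx → ℓ-full (x , Px , ℓx)) a deg

module _ {N : ℕ} where

  _⊆_ : VSet N → VSet N → Set
  S ⊆ T = ∀ x → S x ≡ true → T x ≡ true

  ｛_｝ : Fin N → VSet N
  ｛ a ｝ x = ⌊ x ≟ a ⌋

  elements : VSet N → List (Fin N)
  elements T = filterᵇ T (allFin N)

  sum-map-elements : ∀ T (g : Fin N → ℕ) → List.sum (map g (elements T)) ≡ ∑[ z < N ] (boolToℕ (T z) * g z)
  sum-map-elements T g = trans (sum-map-filter (T? ∘ T) g (allFin N)) (sum-map-allFin (λ z → boolToℕ (T z) * g z))

  length-map-elements : ∀ (f : Fin N → VSet N) T → length (map f (elements T)) ≡ count T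
  length-map-elements f T = trans (length-map f (elements T))
    (trans (length-filter (T? ∘ T) (allFin N)) (sum-map-allFin (boolToℕ ∘ T)))

  countIn-∷-map-elements : ∀ Q (f : Fin N → VSet N) T x →
    countIn (Q ∷ map f (elements T)) x ≡ boolToℕ (Q x) + ∑[ z < N ] (boolToℕ (T z) * boolToℕ (f z x))
  countIn-∷-map-elements Q f T x =
    cong (boolToℕ (Q x) +_) (trans (cong List.sum (sym (map-∘ (elements T)))) (sum-map-elements T _))

  countBoth-∷-map-elements : ∀ Q (f : Fin N → VSet N) T x y →
    countBoth (Q ∷ map f (elements T)) x y ≡ boolToℕ (Q x ∧ Q y) + ∑[ z < N ] (boolToℕ (T z) * boolToℕ (f z x ∧ f z y))
  countBoth-∷-map-elements Q f T x y =
    cong (boolToℕ (Q x ∧ Q y) +_) (trans (cong List.sum (sym (map-∘ (elements T)))) (sum-map-elements T _))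

  _─_ : VSet N → Fin N → VSet N
  (S ─ c) x = S x ∧ not ⌊ c ≟ x ⌋

  ─-≢ : ∀ {S c x} → S x ≡ true → c ≢ x → (S ─ c) x ≡ true
  ─-≢ Sx c≢x = cong₂ (λ a b → a ∧ not b) Sx (⌊≟⌋-≢ c≢x)

  count-─ : ∀ {S c} → S c ≡ true → suc (count (S ─ c)) ≡ count S
  count-─ {S} {c} Sc = begin
    suc (count (S ─ c))                                      ≡⟨ +-comm 1 _ ⟩
    count (S ─ c) + 1                                        ≡⟨ cong (count (S ─ c) +_) (cong boolToℕ Sc) ⟨
    count (S ─ c) + boolToℕ (S c)                            ≡⟨ cong (count (S ─ c) +_) (∑-select S c) ⟨
    count (S ─ c) + ∑[ z < N ] (boolToℕ (S z) * boolToℕ ⌊ c ≟ z ⌋)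
                                                             ≡⟨ cong (count (S ─ c) +_) (sum-cong-≗ λ z → boolToℕ-∧ (S z) _) ⟨
    count (S ─ c) + count (λ z → S z ∧ ⌊ c ≟ z ⌋)            ≡⟨ ∑-distrib-+ (boolToℕ ∘ (S ─ c)) _ ⟨
    ∑[ z < N ] (boolToℕ ((S ─ c) z) + boolToℕ (S z ∧ ⌊ c ≟ z ⌋)) ≡⟨ sum-cong-≗ (λ z → boolToℕ-∧-not (S z) ⌊ c ≟ z ⌋) ⟩
    count S                                                  ∎
    where open ≡-Reasoning

  elements-⊆ : ∀ {A : Fin N → Set} T → (∀ z → T z ≡ true → A z) → All A (elements T)
  elements-⊆ T T⇒A = All.map (λ {z} Tz → T⇒A z (Equivalence.to Bool.T-≡ Tz)) (all-filter (T? ∘ T) (allFin N))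

  withSingletons : VSet N → VSet N → List (VSet N)
  withSingletons P T = P ∷ map ｛_｝ (elements T)

  withSingletons-⊆ : ∀ {P T} → T ⊆ P → All (_⊆ P) (withSingletons P T)
  withSingletons-⊆ {P} {T} T⊆P = (λ _ Px → Px)
    ∷ map⁺ (elements-⊆ T λ z Tz x x≟z → subst (λ w → P w ≡ true) (sym (⌊≟⌋⇒≡ x≟z)) (T⊆P z Tz))

  withSingletons-pairs : ∀ P T → PairsOnce P (withSingletons P T)
  withSingletons-pairs P T x y Px Py x≢y = trans (countBoth-∷-map-elements P ｛_｝ T x y)
    (cong₂ _+_ (cong₂ (λ a b → boolToℕ (a ∧ b)) Px Py) (∑-two-points T x≢y))

  countIn-withSingletons : ∀ P T x → countIn (withSingletons P T) x ≡ boolToℕ (P x) + boolToℕ (T x)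
  countIn-withSingletons P T x = trans (countIn-∷-map-elements P ｛_｝ T x) (cong (boolToℕ (P x) +_) (∑-select T x))

  length-withSingletons : ∀ P T → length (withSingletons P T) ≡ suc (count T)
  length-withSingletons P T = cong suc (length-map-elements ｛_｝ T)

  pairSet : Fin N → Fin N → VSet N
  pairSet c z x = ⌊ c ≟ x ⌋ ∨ ⌊ x ≟ z ⌋

  -- A representation of the complete graph on P by count P cliques.
  nearPencil : VSet N → Fin N → List (VSet N)
  nearPencil P c = (P ─ c) ∷ map (pairSet c) (elements (P ─ c))

  nearPencil-⊆ : ∀ {P c} → P c ≡ true → All (_⊆ P) (nearPencil P c)
  nearPencil-⊆ {P} {c} Pc = (λ _ e → proj₁ (∧-true e)) ∷ map⁺ (elements-⊆ (P ─ c) on-pair)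
    where
    on-pair : ∀ z → (P ─ c) z ≡ true → pairSet c z ⊆ P
    on-pair z P─cz x x∈cz with c ≟ x
    ... | yes refl = Pc
    ... | no  _    = subst (λ w → P w ≡ true) (sym (⌊≟⌋⇒≡ x∈cz)) (proj₁ (∧-true P─cz))

  nearPencil-pairs : ∀ {P c} → P c ≡ true → PairsOnce P (nearPencil P c)
  nearPencil-pairs {P} {c} Pc x y Px Py x≢y
    rewrite countBoth-∷-map-elements (P ─ c) (pairSet c) (P ─ c) x y with c ≟ x | c ≟ y
  ... | yes refl | yes refl = contradiction refl x≢y
  ... | yes refl | no c≢y   = cong₂ _+_ (cong (λ a → boolToℕ ((a ∧ false) ∧ (P y ∧ true))) Pc)
                                        (trans (∑-select (P ─ c) y) (cong boolToℕ (─-≢ {S = P} Py c≢y)))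
  ... | no c≢x   | yes refl = cong₂ _+_ (cong₂ (λ a b → boolToℕ ((a ∧ true) ∧ (b ∧ false))) Px Pc)
                                        (trans (sum-cong-≗ λ z → cong (λ b → boolToℕ ((P ─ c) z) * boolToℕ b) (Bool.∧-identityʳ _))
                                               (trans (∑-select (P ─ c) x) (cong boolToℕ (─-≢ {S = P} Px c≢x))))
  ... | no c≢x   | no c≢y   = cong₂ _+_ (cong₂ (λ a b → boolToℕ ((a ∧ true) ∧ (b ∧ true))) Px Py) (∑-two-points (P ─ c) x≢y)

  nearPencil-twice : ∀ {P c} → 3 ≤ count P → P c ≡ true → ∀ x → P x ≡ true → 2 ≤ countIn (nearPencil P c) x
  nearPencil-twice {P} {c} 3≤|P| Pc x Px rewrite countIn-∷-map-elements (P ─ c) (pairSet c) (P ─ c) x with c ≟ x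
  ... | yes refl = ≤-trans (≤-pred (subst (3 ≤_) (sym (count-─ Pc)) 3≤|P|))
                           (≤-trans (≤-reflexive (sum-cong-≗ λ z → sym (*-identityʳ (boolToℕ ((P ─ c) z)))))
                                    (m≤n+m _ (boolToℕ (P c ∧ false))))
  ... | no  c≢x  = ≤-reflexive (sym (cong₂ _+_ (cong (λ a → boolToℕ (a ∧ true)) Px)
                                               (trans (∑-select (P ─ c) x) (cong boolToℕ (─-≢ {S = P} Px c≢x)))))

  length-nearPencil : ∀ {P c} → P c ≡ true → length (nearPencil P c) ≡ count P
  length-nearPencil {P} {c} Pc = trans (cong suc (length-map-elements (pairSet c) (P ─ c))) (count-─ Pc)

module _ {N : ℕ} where

  RepWith : Graph N → (Fin N → ℕ) → List (VSet N) → Set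
  RepWith H demand L = All (Clique H) L
                     × (∀ x y → E H x y ≡ true → countBoth L x y ≡ 1)
                     × (∀ x → V H x ≡ true → demand x ≤ countIn L x)

  twiceExceptOnceAt : Fin N → Fin N → ℕ
  twiceExceptOnceAt a x = 2 ∸ boolToℕ ⌊ x ≟ a ⌋

  ClosedNbhdIn : Graph N → Fin N → List (VSet N) → Set
  ClosedNbhdIn H a = Any (λ S → ∀ y → S y ≡ ClosedNbhd H a y)

  twiceExceptOnceAt-≢ : ∀ {a x} → x ≢ a → twiceExceptOnceAt a x ≡ 2
  twiceExceptOnceAt-≢ x≢a = cong (λ b → 2 ∸ boolToℕ b) (⌊≟⌋-≢ x≢a)

IsV-unique : ∀ {N} {H : Graph N} {r s} → IsV H r → IsV H s → r ≡ s
IsV-unique ((L , rep , refl) , minimal) ((M , rep′ , refl) , minimal′) = ≤-antisym (minimal M rep′) (minimal′ L rep)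

module _ {N} {H : Graph N} (H-graph : IsGraph H) where
  open IsGraph H-graph

  E⇒≢ : ∀ {x y} → E H x y ≡ true → x ≢ y
  E⇒≢ {x} Exy refl = contradiction (trans (sym Exy) (irrefl x)) λ ()

  ⊆-singleton-edge-free : ∀ {a S x y} → S ⊆ ｛ a ｝ → E H x y ≡ true → boolToℕ (S x ∧ S y) ≡ 0
  ⊆-singleton-edge-free {a} {S} {x} {y} S⊆a Exy with S x in Sx | S y in Sy
  ... | false | _     = refl
  ... | true  | false = refl
  ... | true  | true  = contradiction (trans (⌊≟⌋⇒≡ (S⊆a x Sx)) (sym (⌊≟⌋⇒≡ (S⊆a y Sy)))) (E⇒≢ Exy)

  singleton-clique : ∀ {a} → V H a ≡ true → Clique H ｛ a ｝
  singleton-clique Va = (λ x xa → subst (λ z → V H z ≡ true) (sym (⌊≟⌋⇒≡ xa)) Va)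
                      , (λ x y xa ya → contradiction (trans (⌊≟⌋⇒≡ xa) (sym (⌊≟⌋⇒≡ ya))))

  add-singleton : ∀ {a M} → V H a ≡ true → RepWith H (twiceExceptOnceAt a) M → Rep H (M ++ ｛ a ｝ ∷ [])
  add-singleton {a} {M} Va (cliques , edges , vertices) = ++⁺ cliques (singleton-clique Va ∷ []) , edges′ , vertices′
    where
    edges′ : ∀ x y → E H x y ≡ true → countBoth (M ++ ｛ a ｝ ∷ []) x y ≡ 1
    edges′ x y Exy = trans (countBoth-++ M _ x y)
      (cong₂ _+_ (edges x y Exy) (cong (_+ 0) (⊆-singleton-edge-free {S = ｛ a ｝} (λ _ xa → xa) Exy)))
    vertices′ : ∀ x → V H x ≡ true → 2 ≤ countIn (M ++ ｛ a ｝ ∷ []) x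
    vertices′ x Vx = begin
      2                                          ≡⟨ m∸n+n≡m (≤-trans (boolToℕ≤1 ⌊ x ≟ a ⌋) (s≤s z≤n)) ⟨
      twiceExceptOnceAt a x + boolToℕ ⌊ x ≟ a ⌋  ≤⟨ +-mono-≤ (vertices x Vx) (m≤m+n _ 0) ⟩
      countIn M x + countIn (｛ a ｝ ∷ []) x      ≡⟨ countIn-++ M _ x ⟨
      countIn (M ++ ｛ a ｝ ∷ []) x               ∎
      where open ≤-Reasoning

  -- The clique through a vertex covered only once must contain every edge at that vertex.
  covered-once : ∀ {a d M} → RepWith H d M → V H a ≡ true → countIn M a ≡ 1 → Interior H a × ClosedNbhdIn H a M
  covered-once {a} {d} {M} (cliques , edges , _) Va once =
    (Va , nbhd-clique) , Any.map (λ eq → subst (λ S → ∀ y → S y ≡ ClosedNbhd H a y) eq Q≡N[a]) (∈-lookup i)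
    where
    a-once : count (λ j → lookup M j a) ≡ 1
    a-once = trans (sym (countIn≡count M a)) once
    clique-through-a = 0<∑⇒∃ (λ j → boolToℕ (lookup M j a)) (≤-reflexive (sym a-once))
    i = proj₁ clique-through-a
    Q = lookup M i
    Qa : Q a ≡ true
    Qa = boolToℕ-positive (proj₂ clique-through-a)
    Q-clique : Clique H Q
    Q-clique = All.lookup cliques (∈-lookup i)
    only-Q : ∀ {j} → lookup M j a ≡ true → j ≡ i
    only-Q Mja = count-unique (λ j → lookup M j a) (≤-reflexive a-once) Mja Qa
    neighbour∈Q : ∀ {y} → E H a y ≡ true → Q y ≡ true
    neighbour∈Q {y} Eay with 0<∑⇒∃ (λ j → boolToℕ (lookup M j a ∧ lookup M j y)) (≤-reflexive (sym (trans (sym (countBoth≡count M a y)) (edges a y Eay))))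
    ... | j , 0<j = let (Mja , Mjy) = ∧-true (boolToℕ-positive 0<j) in subst (λ k → lookup M k y ≡ true) (only-Q Mja) Mjy
    Q≡N[a] : ∀ y → Q y ≡ ClosedNbhd H a y
    Q≡N[a] y with a ≟ y
    ... | yes refl = Qa
    ... | no  a≢y with E H a y in Eay
    ...   | true  = neighbour∈Q Eay
    ...   | false = ¬-not λ Qy → contradiction (trans (sym (proj₂ Q-clique a y Qa Qy a≢y)) Eay) λ ()
    nbhd-clique : Clique H (Nbhd H a)
    nbhd-clique = (λ y Eay → proj₁ Q-clique y (neighbour∈Q Eay))
                , (λ y z Eay Eaz → proj₂ Q-clique y z (neighbour∈Q Eay) (neighbour∈Q Eaz))

  -- Every other clique through a meets the closed neighbourhood of a in a only, so it is {a}.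
  drop-extra-clique : ∀ {a L} → Rep H L → V H a ≡ true → ClosedNbhdIn H a L →
                      ∃ λ M → suc (length M) ≡ length L × RepWith H (twiceExceptOnceAt a) M
  drop-extra-clique {a} {L} (cliques , edges , vertices) Va N[a]∈L =
    removeAt L i₁ , sym (length-removeAt′ L i₁) , All-removeAt cliques i₁ , edges′ , vertices′
    where
    i₀ = Any.index N[a]∈L
    Q₀≡N[a] : ∀ y → lookup L i₀ y ≡ ClosedNbhd H a y
    Q₀≡N[a] = lookup-index N[a]∈L
    Q₀a : lookup L i₀ a ≡ true
    Q₀a = trans (Q₀≡N[a] a) (cong (_∨ E H a a) (⌊≟⌋-refl a))
    second = count-other (λ i → lookup L i a) Q₀a (subst (2 ≤_) (countIn≡count L a) (vertices a Va))
    i₁ = proj₁ second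
    Q₁ = lookup L i₁
    Q₁⊆a : Q₁ ⊆ ｛ a ｝
    Q₁⊆a y Q₁y with y ≟ a
    ... | yes _   = refl
    ... | no  y≢a = contradiction (count-unique _ (≤-reflexive pair-once) (cong₂ _∧_ Q₁a Q₁y) (cong₂ _∧_ Q₀a Q₀y)) i₁≢i₀
      where
      i₁≢i₀ = proj₁ (proj₂ second)
      Q₁a = proj₂ (proj₂ second)
      Eay = proj₂ (All.lookup cliques (∈-lookup i₁)) a y Q₁a Q₁y (y≢a ∘ sym)
      Q₀y = trans (Q₀≡N[a] y) (trans (cong (⌊ a ≟ y ⌋ ∨_) Eay) (Bool.∨-zeroʳ _))
      pair-once = trans (sym (countBoth≡count L a y)) (edges a y Eay)
    M = removeAt L i₁
    edges′ : ∀ x y → E H x y ≡ true → countBoth M x y ≡ 1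
    edges′ x y Exy = trans (sym (cong (_+ countBoth M x y) (⊆-singleton-edge-free Q₁⊆a Exy)))
                           (trans (sym (sum-map-removeAt (λ S → boolToℕ (S x ∧ S y)) L i₁)) (edges x y Exy))
    vertices′ : ∀ x → V H x ≡ true → twiceExceptOnceAt a x ≤ countIn M x
    vertices′ x Vx = begin
      2 ∸ boolToℕ ⌊ x ≟ a ⌋                   ≤⟨ ∸-monoʳ-≤ 2 Q₁x≤x≟a ⟩
      2 ∸ boolToℕ (Q₁ x)                      ≤⟨ ∸-monoˡ-≤ (boolToℕ (Q₁ x)) (vertices x Vx) ⟩
      countIn L x ∸ boolToℕ (Q₁ x)            ≡⟨ cong (_∸ boolToℕ (Q₁ x)) (sum-map-removeAt (λ S → boolToℕ (S x)) L i₁) ⟩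
      boolToℕ (Q₁ x) + countIn M x ∸ boolToℕ (Q₁ x) ≡⟨ m+n∸m≡n (boolToℕ (Q₁ x)) (countIn M x) ⟩
      countIn M x                              ∎
      where
      open ≤-Reasoning
      Q₁x≤x≟a : boolToℕ (Q₁ x) ≤ boolToℕ ⌊ x ≟ a ⌋
      Q₁x≤x≟a with Q₁ x in Q₁x
      ... | false = z≤n
      ... | true  = ≤-reflexive (cong boolToℕ (sym (Q₁⊆a x Q₁x)))

  -- If a is covered only once, adding the singleton {a} gives a representation that is minimal
  -- whenever M was too short, and it contains N[a]: so a would be extremal.
  v≤deficient-rep : ∀ {a r M} → IsV H r → ¬ ExtremalInterior H a → RepWith H (twiceExceptOnceAt a) M → r ≤ length M
  v≤deficient-rep {a} {r} {M} (_ , minimal) not-extremal rep@(cliques , edges , vertices)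
    with V H a Bool.≟ true | 2 ≤? countIn M a
  ... | no ¬Va | _ = minimal M (cliques , edges , twice)
    where
    twice : ∀ x → V H x ≡ true → 2 ≤ countIn M x
    twice x Vx = subst (_≤ countIn M x) (twiceExceptOnceAt-≢ {a = a} {x = x} λ { refl → ¬Va Vx }) (vertices x Vx)
  ... | yes Va | yes 2≤a = minimal M (cliques , edges , twice)
    where
    twice : ∀ x → V H x ≡ true → 2 ≤ countIn M x
    twice x Vx with x ≟ a
    ... | yes refl = 2≤a
    ... | no  x≢a  = subst (_≤ countIn M x) (twiceExceptOnceAt-≢ {a = a} x≢a) (vertices x Vx)
  ... | yes Va | no 2≰a with r ≤? length M
  ...   | yes r≤M = r≤M
  ...   | no  r≰M = contradiction extremal not-extremal
    where
    once : countIn M a ≡ 1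
    once = ≤-antisym (≤-pred (≰⇒> 2≰a)) (subst (_≤ countIn M a) (cong (λ b → 2 ∸ boolToℕ b) (⌊≟⌋-refl a)) (vertices a Va))
    M′ = M ++ ｛ a ｝ ∷ []
    rep′ : Rep H M′
    rep′ = add-singleton Va rep
    r≡M′ : r ≡ length M′
    r≡M′ = ≤-antisym (minimal M′ rep′) (≤-trans (≤-reflexive (trans (length-++ M) (+-comm (length M) 1))) (≰⇒> r≰M))
    extremal : ExtremalInterior H a
    extremal = proj₁ (covered-once rep Va once)
             , M′ , rep′ , subst (IsV H) r≡M′ ((M′ , rep′ , sym r≡M′) , minimal)
             , ++⁺ˡ (proj₂ (covered-once rep Va once))

module Deletion {N} (G : Graph N) (G-graph : IsGraph G) (C : VSet N) (C-clique : Clique G C) where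
  open IsGraph G-graph

  G⁻ : Graph N
  G⁻ = Gminus G C

  E⁻ : Fin N → Fin N → Bool
  E⁻ = Eminus G C

  V⁻ : VSet N
  V⁻ = Vminus G C

  V⁻∩C : VSet N
  V⁻∩C x = V⁻ x ∧ C x

  E⁻⇒E : ∀ {x y} → E⁻ x y ≡ true → E G x y ≡ true
  E⁻⇒E E⁻xy = proj₁ (∧-true E⁻xy)

  E⁻-leaves-C : ∀ {x y} → E⁻ x y ≡ true → C x ≡ true → C y ≡ true → ⊥
  E⁻-leaves-C E⁻xy Cx Cy = contradiction (trans (sym (proj₂ (∧-true E⁻xy))) (cong₂ (λ a b → not (a ∧ b)) Cx Cy)) λ ()

  E⇒E⁻ : ∀ {x y} → E G x y ≡ true → (C x ∧ C y) ≡ false → E⁻ x y ≡ true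
  E⇒E⁻ Exy not-both = cong₂ (λ a b → a ∧ not b) Exy not-both

  E⁻⇒V⁻ : ∀ {x y} → E⁻ x y ≡ true → V⁻ x ≡ true
  E⁻⇒V⁻ {x} E⁻xy = trans (cong (V G x ∧ not (C x) ∨_) (any-allFin⁺ (E⁻ x) E⁻xy)) (Bool.∨-zeroʳ _)

  V∖C⇒V⁻ : ∀ {x} → V G x ≡ true → C x ≡ false → V⁻ x ≡ true
  V∖C⇒V⁻ {x} Vx Cx = cong (_∨ any (E⁻ x) (allFin N)) (cong₂ (λ a b → a ∧ not b) Vx Cx)

  V⁻∩C⇒neighbour : ∀ {x} → V⁻∩C x ≡ true → ∃ λ y → E⁻ x y ≡ true
  V⁻∩C⇒neighbour {x} Ax with ∧-true {V⁻ x} Ax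
  ... | V⁻x , Cx with ∨-true {V G x ∧ not (C x)} V⁻x
  ...   | inj₁ V∖Cx = contradiction (trans (sym (proj₂ (∧-true {V G x} V∖Cx))) (cong not Cx)) λ ()
  ...   | inj₂ any-E⁻ = any-allFin⁻ (E⁻ x) any-E⁻

  V⁻⇒V : ∀ {x} → V⁻ x ≡ true → V G x ≡ true
  V⁻⇒V {x} V⁻x with ∨-true {V G x ∧ not (C x)} V⁻x
  ... | inj₁ V∖Cx = proj₁ (∧-true {V G x} V∖Cx)
  ... | inj₂ any-E⁻ = let (y , E⁻xy) = any-allFin⁻ (E⁻ x) any-E⁻ in closed x y (E⁻⇒E E⁻xy)

  G⁻-graph : IsGraph G⁻
  G⁻-graph = record
    { symm   = λ x y → cong₂ (λ a b → a ∧ not b) (symm x y) (Bool.∧-comm (C x) (C y))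
    ; irrefl = λ x → cong (λ a → a ∧ not (C x ∧ C x)) (irrefl x)
    ; closed = λ x y → E⁻⇒V⁻
    }

  Clique⁻⇒Clique : ∀ {S} → Clique G⁻ S → Clique G S
  Clique⁻⇒Clique (S⊆V⁻ , S-edges) = (λ x Sx → V⁻⇒V (S⊆V⁻ x Sx)) , (λ x y Sx Sy x≢y → E⁻⇒E (S-edges x y Sx Sy x≢y))

  ⊆C⇒Clique : ∀ {S} → S ⊆ C → Clique G S
  ⊆C⇒Clique S⊆C = (λ x Sx → proj₁ C-clique x (S⊆C x Sx)) , (λ x y Sx Sy → proj₂ C-clique x y (S⊆C x Sx) (S⊆C y Sy))

  -- Every edge of G lies either in G⁻ or inside C, never in both.
  glue : ∀ {M K} → All (Clique G⁻) M → (∀ x y → E⁻ x y ≡ true → countBoth M x y ≡ 1) →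
         All (_⊆ C) K → PairsOnce C K → (∀ x → V G x ≡ true → 2 ≤ countIn (M ++ K) x) → Rep G (M ++ K)
  glue {M} {K} M-cliques M-edges K⊆C K-pairs vertices =
    ++⁺ (All.map Clique⁻⇒Clique M-cliques) (All.map ⊆C⇒Clique K⊆C) , edges , vertices
    where
    edges : ∀ x y → E G x y ≡ true → countBoth (M ++ K) x y ≡ 1
    edges x y Exy with C x ∧ C y in Cxy
    ... | true  = trans (countBoth-++ M K x y) (cong₂ _+_ (countBoth-absent (All.map not-in-G⁻ M-cliques)) K-once)
      where
      Cx = proj₁ (∧-true Cxy)
      Cy = proj₂ (∧-true Cxy)
      K-once = K-pairs x y Cx Cy (E⇒≢ G-graph Exy)
      not-in-G⁻ : ∀ {S} → Clique G⁻ S → (S x ∧ S y) ≢ true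
      not-in-G⁻ S-clique Sxy = let (Sx , Sy) = ∧-true Sxy in
        E⁻-leaves-C (proj₂ S-clique x y Sx Sy (E⇒≢ G-graph Exy)) Cx Cy
    ... | false = trans (countBoth-++ M K x y)
                        (trans (cong₂ _+_ (M-edges x y (E⇒E⁻ Exy Cxy)) (countBoth-absent (All.map not-in-C K⊆C))) (+-identityʳ 1))
      where
      not-in-C : ∀ {S} → S ⊆ C → (S x ∧ S y) ≢ true
      not-in-C S⊆C Sxy = let (Sx , Sy) = ∧-true Sxy in
        contradiction (trans (sym Cxy) (cong₂ _∧_ (S⊆C x Sx) (S⊆C y Sy))) λ ()

  glue-nearPencil : 3 ≤ count C → ∀ {L⁻} → Rep G⁻ L⁻ → ∃ λ L → Rep G L × length L ≡ length L⁻ + count C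
  glue-nearPencil 3≤|C| {L⁻} (cliques , edges , vertices) =
    L⁻ ++ nearPencil C c ,
    glue cliques edges (nearPencil-⊆ Cc) (nearPencil-pairs Cc) twice ,
    trans (length-++ L⁻) (cong (length L⁻ +_) (length-nearPencil {P = C} Cc))
    where
    c = proj₁ (1≤count⇒∃ C (≤-trans (s≤s z≤n) 3≤|C|))
    Cc = proj₂ (1≤count⇒∃ C (≤-trans (s≤s z≤n) 3≤|C|))
    twice : ∀ x → V G x ≡ true → 2 ≤ countIn (L⁻ ++ nearPencil C c) x
    twice x Vx = subst (2 ≤_) (sym (countIn-++ L⁻ (nearPencil C c) x)) (split (C x Bool.≟ true))
      where
      split : Dec (C x ≡ true) → 2 ≤ countIn L⁻ x + countIn (nearPencil C c) x
      split (yes Cx) = ≤-trans (nearPencil-twice 3≤|C| Cc x Cx) (m≤n+m _ (countIn L⁻ x))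
      split (no ¬Cx) = ≤-trans (vertices x (V∖C⇒V⁻ Vx (¬-not ¬Cx))) (m≤m+n _ _)

  glue-singletons : ∀ {M T} → All (Clique G⁻) M → (∀ x y → E⁻ x y ≡ true → countBoth M x y ≡ 1) → T ⊆ C →
    (∀ x → V G x ≡ true → 2 ≤ countIn M x + (boolToℕ (C x) + boolToℕ (T x))) →
    Rep G (M ++ withSingletons C T)
  glue-singletons {M} {T} cliques edges T⊆C vertices =
    glue cliques edges (withSingletons-⊆ T⊆C) (withSingletons-pairs C T) λ x Vx →
      subst (2 ≤_) (sym (trans (countIn-++ M _ x) (cong (countIn M x +_) (countIn-withSingletons C T x)))) (vertices x Vx)

  length-glue-singletons : ∀ M T → length (M ++ withSingletons C T) ≡ length M + suc (count T)
  length-glue-singletons M T = trans (length-++ M) (cong (length M +_) (length-withSingletons C T))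

  outside-V⁻ : ∀ {x} → V G x ≡ true → V⁻ x ≡ false → C x ≡ true
  outside-V⁻ Vx V⁻x = ¬-not λ Cx → contradiction (trans (sym (V∖C⇒V⁻ Vx Cx)) V⁻x) λ ()

  -- Both attachment points already lie on two cliques of G⁻, so C together with singletons
  -- for the rest of C suffices.
  two-attachments : ∀ {a₁ a₂} → a₁ ≢ a₂ → V⁻∩C a₁ ≡ true → V⁻∩C a₂ ≡ true → ∀ {L⁻} → Rep G⁻ L⁻ →
                    ∃ λ L → Rep G L × suc (length L) ≡ length L⁻ + count C
  two-attachments {a₁} {a₂} a₁≢a₂ A₁ A₂ {L⁻} (cliques , edges , vertices) =
    L⁻ ++ withSingletons C T , glue-singletons cliques edges T⊆C twice , length-eq
    where
    T = (C ─ a₁) ─ a₂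
    T⊆C : T ⊆ C
    T⊆C x Tx = proj₁ (∧-true (proj₁ (∧-true Tx)))
    twice : ∀ x → V G x ≡ true → 2 ≤ countIn L⁻ x + (boolToℕ (C x) + boolToℕ (T x))
    twice x Vx with V⁻ x in V⁻x
    ... | true  = ≤-trans (vertices x V⁻x) (m≤m+n _ _)
    ... | false = ≤-trans (≤-reflexive (cong₂ (λ a b → boolToℕ a + boolToℕ b) (sym Cx) (sym Tx))) (m≤n+m _ (countIn L⁻ x))
      where
      Cx = outside-V⁻ Vx V⁻x
      ≢x : ∀ {a} → V⁻∩C a ≡ true → a ≢ x
      ≢x A refl = contradiction (trans (sym (proj₁ (∧-true A))) V⁻x) λ ()
      Tx : T x ≡ true
      Tx = ─-≢ {S = C ─ a₁} (─-≢ {S = C} Cx (≢x A₁)) (≢x A₂)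
    length-eq : suc (length (L⁻ ++ withSingletons C T)) ≡ length L⁻ + count C
    length-eq = begin
      suc (length (L⁻ ++ withSingletons C T))  ≡⟨ cong suc (length-glue-singletons L⁻ T) ⟩
      suc (length L⁻ + suc (count T))          ≡⟨ +-suc (length L⁻) _ ⟨
      length L⁻ + suc (suc (count T))          ≡⟨ cong (λ k → length L⁻ + suc k) (count-─ {S = C ─ a₁} (─-≢ {S = C} (proj₂ (∧-true {V⁻ a₂} A₂)) a₁≢a₂)) ⟩
      length L⁻ + suc (count (C ─ a₁))         ≡⟨ cong (length L⁻ +_) (count-─ {S = C} (proj₂ (∧-true {V⁻ a₁} A₁))) ⟩
      length L⁻ + count C                      ∎
      where open ≡-Reasoning

  -- Trade the clique {a} accompanying N[a] for C; singletons then cover the rest of C.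
  extremal-attachment : ∀ {a} → V⁻∩C a ≡ true → ∀ {L⁻} → Rep G⁻ L⁻ → ClosedNbhdIn G⁻ a L⁻ →
                        ∃ λ L → Rep G L × suc (length L) ≡ length L⁻ + count C
  extremal-attachment {a} Aa {L⁻} rep⁻ N[a]∈L⁻ with drop-extra-clique G⁻-graph rep⁻ V⁻a N[a]∈L⁻
    where
    V⁻a = proj₁ (∧-true {V⁻ a} Aa)
  ... | M , M+1≡L⁻ , (cliques , edges , vertices) =
    M ++ withSingletons C (C ─ a) , glue-singletons cliques edges (λ x e → proj₁ (∧-true e)) twice , length-eq
    where
    Ca = proj₂ (∧-true {V⁻ a} Aa)
    twice : ∀ x → V G x ≡ true → 2 ≤ countIn M x + (boolToℕ (C x) + boolToℕ ((C ─ a) x))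
    twice x Vx with V⁻ x Bool.≟ true | x ≟ a
    ... | yes V⁻x | no x≢a   = ≤-trans (≤-reflexive (sym (twiceExceptOnceAt-≢ {a = a} x≢a))) (≤-trans (vertices x V⁻x) (m≤m+n _ _))
    ... | yes V⁻x | yes refl = +-mono-≤ (subst (_≤ countIn M a) (cong (λ b → 2 ∸ boolToℕ b) (⌊≟⌋-refl a)) (vertices a V⁻x))
                                        (≤-trans (≤-reflexive (cong boolToℕ (sym Ca))) (m≤m+n _ _))
    ... | no ¬V⁻x | _        = ≤-trans (≤-reflexive (cong₂ (λ a b → boolToℕ a + boolToℕ b) (sym Cx) (sym (─-≢ {S = C} Cx a≢x))))
                                       (m≤n+m _ (countIn M x))
      where
      Cx = outside-V⁻ Vx (¬-not ¬V⁻x)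
      a≢x : a ≢ x
      a≢x refl = ¬V⁻x (proj₁ (∧-true {V⁻ a} Aa))
    length-eq : suc (length (M ++ withSingletons C (C ─ a))) ≡ length L⁻ + count C
    length-eq = begin
      suc (length (M ++ withSingletons C (C ─ a)))  ≡⟨ cong suc (length-glue-singletons M (C ─ a)) ⟩
      suc (length M + suc (count (C ─ a)))          ≡⟨⟩
      suc (length M) + suc (count (C ─ a))          ≡⟨ cong₂ _+_ M+1≡L⁻ (count-─ {S = C} Ca) ⟩
      length L⁻ + count C                           ∎
      where open ≡-Reasoning

  MeetsOutside : VSet N → Set
  MeetsOutside S = ∃ λ x → S x ≡ true × C x ≡ false

  meetsOutside? : Decidable MeetsOutside
  meetsOutside? S = any? λ x → (S x Bool.≟ true) ×-dec (C x Bool.≟ false)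

  inside⇒⊆C : ∀ {S} → ¬ MeetsOutside S → S ⊆ C
  inside⇒⊆C ¬meets x Sx = ¬-not λ Cx → ¬meets (x , Sx , Cx)

  outer⇒Clique⁻ : ∀ {a} → (∀ x → V⁻∩C x ≡ true → x ≡ a) → ∀ {S} → Clique G S → MeetsOutside S → Clique G⁻ S
  outer⇒Clique⁻ only-a {S} (S⊆V , S-edges) (z , Sz , Cz) = S⊆V⁻ , edges⁻
    where
    S⊆V⁻ : S ⊆ V⁻
    S⊆V⁻ x Sx with C x Bool.≟ true
    ... | no ¬Cx = V∖C⇒V⁻ (S⊆V x Sx) (¬-not ¬Cx)
    ... | yes Cx = E⁻⇒V⁻ (E⇒E⁻ (S-edges x z Sx Sz x≢z) (cong₂ _∧_ Cx Cz))
      where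
      x≢z : x ≢ z
      x≢z refl = contradiction (trans (sym Cx) Cz) λ ()
    edges⁻ : ∀ x y → S x ≡ true → S y ≡ true → x ≢ y → E⁻ x y ≡ true
    edges⁻ x y Sx Sy x≢y = E⇒E⁻ (S-edges x y Sx Sy x≢y) (¬-not not-both)
      where
      not-both : (C x ∧ C y) ≢ true
      not-both Cxy = let (Cx , Cy) = ∧-true Cxy in
        x≢y (trans (only-a x (cong₂ _∧_ (S⊆V⁻ x Sx) Cx)) (sym (only-a y (cong₂ _∧_ (S⊆V⁻ y Sy) Cy))))

  -- When V⁻ ∩ C ⊆ {a}, the cliques of a representation of G that meet V ∖ C represent G⁻ except that
  -- a may be covered only once, and those inside C cover each pair of C once and each point but a
  -- twice, so that points≤lines applies to them.
  module Split (a : Fin N) (only-a : ∀ x → V⁻∩C x ≡ true → x ≡ a) {L} (rep : Rep G L) where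

    outer inner : List (VSet N)
    outer = filter meetsOutside? L
    inner = filter (¬? ∘ meetsOutside?) L

    outer-cliques : All (Clique G⁻) outer
    outer-cliques = All.map (λ (S-clique , meets) → outer⇒Clique⁻ only-a S-clique meets)
                            (All.zip (filter⁺ meetsOutside? (proj₁ rep) , all-filter meetsOutside? L))

    inner⊆C : All (_⊆ C) inner
    inner⊆C = All.map inside⇒⊆C (all-filter (¬? ∘ meetsOutside?) L)

    countIn-split : ∀ x → countIn L x ≡ countIn outer x + countIn inner x
    countIn-split x = sum-map-partition meetsOutside? (λ S → boolToℕ (S x)) L

    countBoth-split : ∀ x y → countBoth L x y ≡ countBoth outer x y + countBoth inner x y
    countBoth-split x y = sum-map-partition meetsOutside? (λ S → boolToℕ (S x ∧ S y)) L

    outer-edges : ∀ x y → E⁻ x y ≡ true → countBoth outer x y ≡ 1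
    outer-edges x y E⁻xy = begin
      countBoth outer x y                        ≡⟨ +-identityʳ _ ⟨
      countBoth outer x y + 0                    ≡⟨ cong (countBoth outer x y +_) (countBoth-absent (All.map not-inner inner⊆C)) ⟨
      countBoth outer x y + countBoth inner x y  ≡⟨ countBoth-split x y ⟨
      countBoth L x y                            ≡⟨ proj₁ (proj₂ rep) x y (E⁻⇒E E⁻xy) ⟩
      1                                          ∎
      where
      open ≡-Reasoning
      not-inner : ∀ {S} → S ⊆ C → (S x ∧ S y) ≢ true
      not-inner S⊆C Sxy = let (Sx , Sy) = ∧-true Sxy in E⁻-leaves-C E⁻xy (S⊆C x Sx) (S⊆C y Sy)

    outer-vertices : ∀ x → V⁻ x ≡ true → twiceExceptOnceAt a x ≤ countIn outer x
    outer-vertices x V⁻x with C x Bool.≟ true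
    ... | no ¬Cx = ≤-trans (m∸n≤m 2 (boolToℕ ⌊ x ≟ a ⌋)) (≤-trans (proj₂ (proj₂ rep) x (V⁻⇒V V⁻x)) (≤-reflexive only-outer))
      where
      only-outer : countIn L x ≡ countIn outer x
      only-outer = trans (countIn-split x)
        (trans (cong (countIn outer x +_) (countIn-absent (All.map (λ S⊆C Sx → ¬Cx (S⊆C x Sx)) inner⊆C))) (+-identityʳ _))
    ... | yes Cx with only-a x (cong₂ _∧_ V⁻x Cx) | V⁻∩C⇒neighbour (cong₂ _∧_ V⁻x Cx)
    ...   | refl | d , E⁻xd = begin
      2 ∸ boolToℕ ⌊ x ≟ x ⌋  ≡⟨ cong (λ b → 2 ∸ boolToℕ b) (⌊≟⌋-refl x) ⟩
      1                      ≡⟨ outer-edges x d E⁻xd ⟨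
      countBoth outer x d    ≤⟨ countBoth≤countIn outer x d ⟩
      countIn outer x        ∎
      where open ≤-Reasoning

    outer-rep : RepWith G⁻ (twiceExceptOnceAt a) outer
    outer-rep = outer-cliques , outer-edges , outer-vertices

    inner-pairs : PairsOnce C inner
    inner-pairs x y Cx Cy x≢y = begin
      countBoth inner x y                        ≡⟨ cong (_+ countBoth inner x y) (countBoth-absent (All.map not-outer outer-cliques)) ⟨
      countBoth outer x y + countBoth inner x y  ≡⟨ countBoth-split x y ⟨
      countBoth L x y                            ≡⟨ proj₁ (proj₂ rep) x y (proj₂ C-clique x y Cx Cy x≢y) ⟩
      1                                          ∎
      where
      open ≡-Reasoning
      not-outer : ∀ {S} → Clique G⁻ S → (S x ∧ S y) ≢ true
      not-outer S-clique Sxy = let (Sx , Sy) = ∧-true Sxy in E⁻-leaves-C (proj₂ S-clique x y Sx Sy x≢y) Cx Cy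

    inner-degree : ∀ x → C x ≡ true → x ≢ a → 2 ≤ count (λ i → lookup inner i x)
    inner-degree x Cx x≢a = begin
      2                                  ≤⟨ proj₂ (proj₂ rep) x (proj₁ C-clique x Cx) ⟩
      countIn L x                        ≡⟨ countIn-split x ⟩
      countIn outer x + countIn inner x  ≡⟨ cong (_+ countIn inner x) (countIn-absent (All.map not-outer outer-cliques)) ⟩
      countIn inner x                    ≡⟨ countIn≡count inner x ⟩
      count (λ i → lookup inner i x)     ∎
      where
      open ≤-Reasoning
      not-outer : ∀ {S} → Clique G⁻ S → S x ≢ true
      not-outer S-clique Sx = x≢a (only-a x (cong₂ _∧_ (proj₁ S-clique x Sx) Cx))

    length-bound : 2 ≤ count C → length outer + count C ≤ length L
    length-bound 2≤|C| = begin
      length outer + count C       ≤⟨ +-monoʳ-≤ (length outer) (LinearSpace.points≤lines C inner inner-pairs 2≤|C| a inner-degree) ⟩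
      length outer + length inner  ≡⟨ length-partition meetsOutside? L ⟨
      length L                     ∎
      where open ≤-Reasoning

  unattached⇒component : 1 ≤ count C → (∀ x → V⁻∩C x ≢ true) → ConnectedComponent G C
  unattached⇒component 1≤|C| unattached = 1≤count⇒∃ C 1≤|C| , proj₁ C-clique , closed-under-E , reach
    where
    closed-under-E : ∀ x y → C x ≡ true → E G x y ≡ true → C y ≡ true
    closed-under-E x y Cx Exy = ¬-not λ Cy → unattached x (cong₂ _∧_ (E⁻⇒V⁻ (E⇒E⁻ Exy (cong₂ _∧_ Cx Cy))) Cx)
    reach : ∀ x y → C x ≡ true → C y ≡ true → Reach G C x y
    reach x y Cx Cy with x ≟ y
    ... | yes refl = here
    ... | no  x≢y  = step (proj₂ C-clique x y Cx Cy x≢y) Cy here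

  component⇒unattached : ConnectedComponent G C → ∀ x → V⁻∩C x ≢ true
  component⇒unattached (_ , _ , closed-under-E , _) x Ax with V⁻∩C⇒neighbour Ax
  ... | y , E⁻xy = E⁻-leaves-C E⁻xy Cx (closed-under-E x y Cx (E⁻⇒E E⁻xy))
    where
    Cx = proj₂ (∧-true {V⁻ x} Ax)

  lower-bound : 3 ≤ count C → ∀ a → (∀ x → V⁻∩C x ≡ true → x ≡ a) → ¬ ExtremalInterior G⁻ a →
                ∀ {r r⁻} → IsV G r → IsV G⁻ r⁻ → r⁻ + count C ≤ r
  lower-bound 3≤|C| a only-a not-extremal ((L , rep , refl) , _) IsV⁻ =
    ≤-trans (+-monoˡ-≤ (count C) (v≤deficient-rep G⁻-graph IsV⁻ not-extremal outer-rep)) (length-bound (≤-trans (n≤1+n 2) 3≤|C|))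
    where open Split a only-a rep

  Condition : Set
  Condition = ConnectedComponent G C
            ⊎ Σ (Fin N) λ a → (∀ x → (V⁻∩C x ≡ true) ⇔ (x ≡ a)) × ¬ ExtremalInterior G⁻ a

  upper-bound : 3 ≤ count C → ∀ {r r⁻} → IsV G r → IsV G⁻ r⁻ → r ≤ r⁻ + count C
  upper-bound 3≤|C| (_ , minimal) ((L⁻ , rep⁻ , refl) , _) with glue-nearPencil 3≤|C| rep⁻
  ... | L , rep , L≡ = ≤-trans (minimal L rep) (≤-reflexive L≡)

  shorter⇒≢ : ∀ {r s} → IsV G r → (∃ λ L → Rep G L × suc (length L) ≡ s) → r ≢ s
  shorter⇒≢ (_ , minimal) (L , rep , 1+L≡s) = <⇒≢ (≤-trans (s≤s (minimal L rep)) (≤-reflexive 1+L≡s))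

  equality⇒condition : 3 ≤ count C → ∀ {r r⁻} → IsV G r → IsV G⁻ r⁻ → r ≡ r⁻ + count C → Condition
  equality⇒condition 3≤|C| IsV-G IsV⁻@((L⁻ , rep⁻ , refl) , _) r≡ with any? (λ x → V⁻∩C x Bool.≟ true)
  ... | no unattached = inj₁ (unattached⇒component (≤-trans (s≤s z≤n) 3≤|C|) λ x Ax → unattached (x , Ax))
  ... | yes (a , Aa) with any? (λ x → (V⁻∩C x Bool.≟ true) ×-dec ¬? (x ≟ a))
  ...   | yes (b , Ab , b≢a) = contradiction r≡ (shorter⇒≢ IsV-G (two-attachments b≢a Ab Aa rep⁻))
  ...   | no  only = inj₂ (a , (λ x → mk⇔ (only-a x) λ { refl → Aa }) , not-extremal)
    where
    only-a : ∀ x → V⁻∩C x ≡ true → x ≡ a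
    only-a x Ax with x ≟ a
    ... | yes x≡a = x≡a
    ... | no  x≢a = contradiction (x , Ax , x≢a) only
    not-extremal : ¬ ExtremalInterior G⁻ a
    not-extremal (_ , L′ , rep′ , IsV′ , N[a]∈L′) with extremal-attachment Aa rep′ N[a]∈L′
    ... | L , rep , 1+L≡ = shorter⇒≢ IsV-G (L , rep , trans 1+L≡ (cong (_+ count C) (IsV-unique IsV′ IsV⁻))) r≡

  condition⇒lower : 3 ≤ count C → ∀ {r r⁻} → IsV G r → IsV G⁻ r⁻ → Condition → r⁻ + count C ≤ r
  condition⇒lower 3≤|C| IsV-G IsV⁻ (inj₁ component@((c , Cc) , _)) =
    lower-bound 3≤|C| c (λ x Ax → ⊥-elim (component⇒unattached component x Ax)) not-interior IsV-G IsV⁻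
    where
    not-interior : ¬ ExtremalInterior G⁻ c
    not-interior ((V⁻c , _) , _) = component⇒unattached component c (cong₂ _∧_ V⁻c Cc)
  condition⇒lower 3≤|C| IsV-G IsV⁻ (inj₂ (a , attached⇔a , not-extremal)) =
    lower-bound 3≤|C| a (λ x → Equivalence.to (attached⇔a x)) not-extremal IsV-G IsV⁻

  theorem : 3 ≤ count C → ∀ {r r⁻} → IsV G r → IsV G⁻ r⁻ → (r ≤ r⁻ + count C) × ((r ≡ r⁻ + count C) ⇔ Condition)
  theorem 3≤|C| IsV-G IsV⁻ =
    r≤r⁻+|C| , mk⇔ (equality⇒condition 3≤|C| IsV-G IsV⁻) (≤-antisym r≤r⁻+|C| ∘ condition⇒lower 3≤|C| IsV-G IsV⁻)
    where
    r≤r⁻+|C| = upper-bound 3≤|C| IsV-G IsV⁻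

mainTheorem13 : {N : ℕ} (G : Graph N) → IsGraph G → (C : VSet N) → Clique G C → 3 ≤ card C →
    (r r⁻ : ℕ) → IsV G r → IsV (Gminus G C) r⁻ →
    (r ≤ r⁻ + card C)
    × ((r ≡ r⁻ + card C) ⇔
        (ConnectedComponent G C
         ⊎ Σ (Fin N) λ a → (∀ x → (Vminus G C x ∧ C x ≡ true) ⇔ (x ≡ a))
                           × ¬ ExtremalInterior (Gminus G C) a))
mainTheorem13 G G-graph C C-clique 3≤|C| r r⁻ IsV-G IsV⁻ rewrite card≡count C =
  Deletion.theorem G G-graph C C-clique 3≤|C| IsV-G IsV⁻
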